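{- Let $(\mathcal{C},\otimes,I)$ be a small productive symmetric monoidal category. Then monoidal streams over $\mathcal{C}$ form a feedback monoidal category $(\mathrm{STREAM},\partial,\mathrm{fbk})$, where $\partial$ is the delay functor and $\mathrm{fbk}$ is the feedback operation on streams; that is, $\mathrm{fbk}$ satisfies the axioms (A1)–(A5) (tightening, vanishing, joining, strength, sliding).
   Context: Composition in diagrammatic order $;$, coherence isomorphisms suppressed. $\mathcal{C}^{\mathbb{N}}$: sequences $\mathbf{X}=(X_0,X_1,\dots)$ of objects of $\mathcal{C}$; $\mathbf{X}^+=(X_1,X_2,\dots)$; $M\cdot\mathbf{X}=(M\otimes X_0,X_1,\dots)$. Productive: for objects $P,Q$ write $\langle h\rangle$ for the class of $h\colon P\to W\otimes Q$ in $\int^W\mathcal{C}(P,W\otimes Q)$ (morphisms with varying $W$ modulo the equivalence generated by $h;(r\otimes1_Q)\sim h$). $\mathcal{C}$ is productive if for all $X_0,Y_0$, every class $\alpha\in\int^M\mathcal{C}(X_0,M\otimes Y_0)$ admits $M_0$, $\alpha_0\colon X_0\to M_0\otimes Y_0$ and for each representative $\alpha_i\colon X_0\to M_i\otimes Y_0$ a morphism $s_i\colon M_0\to M_i$ with $\alpha_i=\alpha_0;(s_i\otimes1)$, such that for all $u\colon M_i\otimes A\to U\otimes B$, $v\colon M_j\otimes A\to V\otimes B$, $\langle(\alpha_i\otimes1_A);(u\otimes1_{Y_0})\rangle=\langle(\alpha_j\otimes1_A);(v\otimes1_{Y_0})\rangle$ implies $\langle(s_i\otimes1_A);u\rangle=\langle(s_j\otimes1_A);v\rangle$.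 Monoidal streams: $\mathrm{STREAM}(\mathbf{X},\mathbf{Y})$ is the final coalgebra of $\Phi(Q)(\mathbf{X},\mathbf{Y})=\int^{M}\mathcal{C}(X_0,M\otimes Y_0)\times Q(M\cdot\mathbf{X}^+,\mathbf{Y}^+)$. A stream $f$ consists of a memory $M(f)$, a first action $\mathrm{now}(f)\colon X_0\to M(f)\otimes Y_0$ and a rest $\mathrm{later}(f)\in\mathrm{STREAM}(M(f)\cdot\mathbf{X}^+,\mathbf{Y}^+)$, quotiented coinductively by the equivalence generated by: $f\sim g$ if there is $r\colon M(g)\to M(f)$ with $\mathrm{now}(f)=\mathrm{now}(g);(r\otimes1)$ and $r\cdot\mathrm{later}(f)\sim\mathrm{later}(g)$ ($r\cdot h$ precomposes the first action of $h$ with $r\otimes1$). Sequential composition with memories: for $f\in\mathrm{STREAM}(A\cdot\mathbf{X},\mathbf{Y})$, $g\in\mathrm{STREAM}(B\cdot\mathbf{Y},\mathbf{Z})$, $f^A;g^B$ has memory $M(f)\otimes M(g)$, first action $\mathrm{now}(f)$ followed by $\mathrm{now}(g)$ (with symmetries), rest $\mathrm{later}(f)^{M(f)};\mathrm{later}(g)^{M(g)}$; $f;g:=f^I;g^I$. Identities: memory $I$, first action identity, rest identity. Tensor: memory $M(f)\otimes M(g)$, first action $\mathrm{now}(f)\otimes\mathrm{now}(g)$ up to symmetries, rest $\mathrm{later}(f)\otimes\mathrm{later}(g)$. This gives a symmetric monoidal category $\mathrm{STREAM}$ whose objects are those of $\mathcal{C}^{\mathbb{N}}$. Delay: $\partial(X_0,X_1,\dots)=(I,X_0,X_1,\dots)$;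 on streams, $\partial f$ has memory $I$, first action $\mathrm{id}_I$ and rest $f$. Feedback: for $f\in\mathrm{STREAM}(N\cdot(\partial\mathbf{S}\otimes\mathbf{X}),\mathbf{S}\otimes\mathbf{Y})$, $\mathrm{fbk}(f^N)\in\mathrm{STREAM}(N\cdot\mathbf{X},\mathbf{Y})$ has memory $M(f)\otimes S_0$, first action $\mathrm{now}(f)$, and rest $\mathrm{fbk}(\mathrm{later}(f)^{M(f)\otimes S_0})$ (note $\mathrm{later}(f)\in\mathrm{STREAM}((M(f)\otimes S_0)\cdot(\partial\mathbf{S}^+\otimes\mathbf{X}^+),\mathbf{S}^+\otimes\mathbf{Y}^+)$); $\mathrm{fbk}_{\mathbf{S}}(f):=\mathrm{fbk}(f^I)$. A feedback monoidal category is a symmetric monoidal category with a symmetric strong monoidal endofunctor $F$ and operations $\mathrm{fbk}_S\colon\mathrm{Hom}(FS\otimes X,S\otimes Y)\to\mathrm{Hom}(X,Y)$ such that: (A1) $u;\mathrm{fbk}_S(f);v=\mathrm{fbk}_S((\mathrm{id}_{FS}\otimes u);f;(\mathrm{id}_S\otimes v))$; (A2) $\mathrm{fbk}_I(f)=f$; (A3) $\mathrm{fbk}_T(\mathrm{fbk}_S(f))=\mathrm{fbk}_{S\otimes T}(f)$; (A4) $\mathrm{fbk}_S(f)\otimes g=\mathrm{fbk}_S(f\otimes g)$; (A5) $\mathrm{fbk}_S((Fh\otimes\mathrm{id});f)=\mathrm{fbk}_T(f;(h\otimes\mathrm{id}))$ for $h\colon S\to T$, $f\colon FT\otimes X\to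 S\otimes Y$. -}

module Defs where

open import Level using (0ℓ)
open import Data.Nat using (ℕ; zero; suc)
open import Data.Product using (Σ; _×_; _,_; proj₁; proj₂)
open import Relation.Binary using (Rel; IsEquivalence)
open import Relation.Binary.Construct.Closure.Equivalence using (EqClosure)

record SymMonCat : Set₁ where
  infixr 9 _⨾_
  infixr 10 _⊗₀_ _⊗₁_
  infix 4 _≈_
  infix 5 _⇒_
  field
    Obj   : Set
    _⇒_   : Obj → Obj → Set
    _≈_   : ∀ {A B} → Rel (A ⇒ B) 0ℓ
    ≈-equiv : ∀ {A B} → IsEquivalence (_≈_ {A} {B})
    id    : ∀ {A} → A ⇒ A
    _⨾_   : ∀ {A B C} → A ⇒ B → B ⇒ C → A ⇒ C
    ⨾-assoc : ∀ {A B C D} {f : A ⇒ B} {g : B ⇒ C} {h : C ⇒ D} →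
              (f ⨾ g) ⨾ h ≈ f ⨾ (g ⨾ h)
    ⨾-idˡ : ∀ {A B} {f : A ⇒ B} → id ⨾ f ≈ f
    ⨾-idʳ : ∀ {A B} {f : A ⇒ B} → f ⨾ id ≈ f
    ⨾-resp : ∀ {A B C} {f f' : A ⇒ B} {g g' : B ⇒ C} →
             f ≈ f' → g ≈ g' → f ⨾ g ≈ f' ⨾ g'
    I     : Obj
    _⊗₀_  : Obj → Obj → Obj
    _⊗₁_  : ∀ {A B C D} → A ⇒ B → C ⇒ D → A ⊗₀ C ⇒ B ⊗₀ D
    ⊗-id  : ∀ {A B} → id {A} ⊗₁ id {B} ≈ id
    ⊗-⨾   : ∀ {A B C D E F} {f : A ⇒ B} {g : B ⇒ C} {h : D ⇒ E} {k : E ⇒ F} →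
            (f ⨾ g) ⊗₁ (h ⨾ k) ≈ (f ⊗₁ h) ⨾ (g ⊗₁ k)
    ⊗-resp : ∀ {A B C D} {f f' : A ⇒ B} {g g' : C ⇒ D} →
             f ≈ f' → g ≈ g' → f ⊗₁ g ≈ f' ⊗₁ g'
    assoc   : ∀ {A B C} → (A ⊗₀ B) ⊗₀ C ⇒ A ⊗₀ (B ⊗₀ C)
    assoc⁻¹ : ∀ {A B C} → A ⊗₀ (B ⊗₀ C) ⇒ (A ⊗₀ B) ⊗₀ C
    assoc-isoˡ : ∀ {A B C} → assoc {A} {B} {C} ⨾ assoc⁻¹ ≈ id
    assoc-isoʳ : ∀ {A B C} → assoc⁻¹ {A} {B} {C} ⨾ assoc ≈ id
    assoc-nat : ∀ {A B C D E F} {f : A ⇒ B} {g : C ⇒ D} {h : E ⇒ F} →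
                ((f ⊗₁ g) ⊗₁ h) ⨾ assoc ≈ assoc ⨾ (f ⊗₁ (g ⊗₁ h))
    lunit   : ∀ {A} → I ⊗₀ A ⇒ A
    lunit⁻¹ : ∀ {A} → A ⇒ I ⊗₀ A
    lunit-isoˡ : ∀ {A} → lunit {A} ⨾ lunit⁻¹ ≈ id
    lunit-isoʳ : ∀ {A} → lunit⁻¹ {A} ⨾ lunit ≈ id
    lunit-nat : ∀ {A B} {f : A ⇒ B} → (id ⊗₁ f) ⨾ lunit ≈ lunit ⨾ f
    runit   : ∀ {A} → A ⊗₀ I ⇒ A
    runit⁻¹ : ∀ {A} → A ⇒ A ⊗₀ I
    runit-isoˡ : ∀ {A} → runit {A} ⨾ runit⁻¹ ≈ id
    runit-isoʳ : ∀ {A} → runit⁻¹ {A} ⨾ runit ≈ id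
    runit-nat : ∀ {A B} {f : A ⇒ B} → (f ⊗₁ id) ⨾ runit ≈ runit ⨾ f
    braid : ∀ {A B} → A ⊗₀ B ⇒ B ⊗₀ A
    braid-nat : ∀ {A B C D} {f : A ⇒ B} {g : C ⇒ D} →
                (f ⊗₁ g) ⨾ braid ≈ braid ⨾ (g ⊗₁ f)
    braid-inv : ∀ {A B} → braid {A} {B} ⨾ braid ≈ id
    pentagon : ∀ {A B C D} →
               (assoc {A} {B} {C} ⊗₁ id {D}) ⨾ assoc ⨾ (id ⊗₁ assoc) ≈ assoc ⨾ assoc
    triangle : ∀ {A B} → assoc {A} {I} {B} ⨾ (id ⊗₁ lunit) ≈ runit ⊗₁ id
    hexagon  : ∀ {A B C} →
               assoc {A} {B} {C} ⨾ braid ⨾ assoc ≈ (braid ⊗₁ id) ⨾ assoc ⨾ (id ⊗₁ braid)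

module _ (C : SymMonCat) where
  open SymMonCat C

  -- representatives of elements of the coend  ∫^W C(P, W ⊗ Q)
  CoendRep : Obj → Obj → Set
  CoendRep P Q = Σ Obj (λ W → P ⇒ W ⊗₀ Q)

  CoendStep : ∀ {P Q} → Rel (CoendRep P Q) 0ℓ
  CoendStep {P} {Q} (W , h) (W' , h') = Σ (W ⇒ W') (λ r → h' ≈ h ⨾ (r ⊗₁ id))

  CoendEq : ∀ {P Q} → Rel (CoendRep P Q) 0ℓ
  CoendEq = EqClosure CoendStep

  swapMid : ∀ {M Y A} → (M ⊗₀ Y) ⊗₀ A ⇒ (M ⊗₀ A) ⊗₀ Y
  swapMid = assoc ⨾ (id ⊗₁ braid) ⨾ assoc⁻¹

  Productive : Set
  Productive =
    (X₀ Y₀ : Obj) (a : CoendRep X₀ Y₀) →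
    Σ Obj λ M₀ → Σ (X₀ ⇒ M₀ ⊗₀ Y₀) λ α₀ →
    Σ ((i : CoendRep X₀ Y₀) → CoendEq a i →
         Σ (M₀ ⇒ proj₁ i) λ s → proj₂ i ≈ α₀ ⨾ (s ⊗₁ id)) λ s →
    (i : CoendRep X₀ Y₀) (ei : CoendEq a i) (j : CoendRep X₀ Y₀) (ej : CoendEq a j)
    (A B U V : Obj) (u : proj₁ i ⊗₀ A ⇒ U ⊗₀ B) (v : proj₁ j ⊗₀ A ⇒ V ⊗₀ B) →
    CoendEq {X₀ ⊗₀ A} {B ⊗₀ Y₀}
            (U , (proj₂ i ⊗₁ id) ⨾ swapMid ⨾ (u ⊗₁ id) ⨾ assoc)
            (V , (proj₂ j ⊗₁ id) ⨾ swapMid ⨾ (v ⊗₁ id) ⨾ assoc) →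
    CoendEq {M₀ ⊗₀ A} {B}
            (U , (proj₁ (s i ei) ⊗₁ id) ⨾ u)
            (V , (proj₁ (s j ej) ⊗₁ id) ⨾ v)

  Seq : Set
  Seq = ℕ → Obj

  tail : Seq → Seq
  tail X n = X (suc n)

  _·_ : Obj → Seq → Seq
  (M · X) zero    = M ⊗₀ X zero
  (M · X) (suc n) = X (suc n)

  _⊗ˢ_ : Seq → Seq → Seq
  (X ⊗ˢ Y) n = X n ⊗₀ Y n

  Iˢ : Seq
  Iˢ _ = I

  ∂ : Seq → Seq
  ∂ X zero    = I
  ∂ X (suc n) = X n

  -- Monoidal streams, represented intensionally by the unfolding of the
  -- coalgebra structure: a stream f ∈ STREAM(X, Y) is given by its
  -- memories  mem n  (M(f) = mem 0, M(later f) = mem 1, …) and actions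
  --   act 0       : X₀            ⇒ mem 0       ⊗ Y₀        (= now f)
  --   act (n + 1) : mem n ⊗ Xₙ₊₁  ⇒ mem (n + 1) ⊗ Yₙ₊₁
  -- (act (n+1) is the first action of laterⁿ⁺¹ f).

  In : (ℕ → Obj) → Seq → ℕ → Obj
  In mem X zero    = X zero
  In mem X (suc n) = mem n ⊗₀ X (suc n)

  record Stream (X Y : Seq) : Set where
    field
      mem : ℕ → Obj
      act : (n : ℕ) → In mem X n ⇒ mem n ⊗₀ Y n
  open Stream public

  M : ∀ {X Y} → Stream X Y → Obj
  M f = mem f zero

  now : ∀ {X Y} → (f : Stream X Y) → X zero ⇒ M f ⊗₀ Y zero
  now f = act f zero

  later : ∀ {X Y} → (f : Stream X Y) → Stream (M f · tail X) (tail Y)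
  later {X} {Y} f = record { mem = λ n → mem f (suc n) ; act = a }
    where
    a : (n : ℕ) → In (λ n → mem f (suc n)) (M f · tail X) n ⇒ mem f (suc n) ⊗₀ tail Y n
    a zero    = act f (suc zero)
    a (suc n) = act f (suc (suc n))

  _·ₛ_ : ∀ {M' M'' X Y} → M' ⇒ M'' → Stream (M'' · X) Y → Stream (M' · X) Y
  _·ₛ_ {M'} {M''} {X} {Y} r h = record { mem = mem h ; act = a }
    where
    a : (n : ℕ) → In (mem h) (M' · X) n ⇒ mem h n ⊗₀ Y n
    a zero    = (r ⊗₁ id) ⨾ act h zero
    a (suc n) = act h (suc n)

  -- Equality of monoidal streams: the coinductive quotient.  A relation
  -- R (on streams of all types) is a "stream congruence candidate" if
  -- R ⊆ EqClosure (Step R), where  Step R f g  holds when there is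
  -- r : M(g) → M(f) with now f ≈ now g ; (r ⊗ 1) and R (r · later f) (later g).
  -- Two streams are equal when related by such an R (greatest fixpoint).

  StreamRel : Set₁
  StreamRel = ∀ {X Y} → Stream X Y → Stream X Y → Set

  Step : StreamRel → StreamRel
  Step R f g = Σ (M g ⇒ M f) λ r →
                 (now f ≈ now g ⨾ (r ⊗₁ id)) × R (r ·ₛ later f) (later g)

  infix 4 _≈ₛ_
  _≈ₛ_ : ∀ {X Y} → Stream X Y → Stream X Y → Set₁
  f ≈ₛ g = Σ StreamRel λ R →
             (∀ {X Y} {f' g' : Stream X Y} → R f' g' → EqClosure (Step R) f' g') × R f g

  lift : ∀ {X Y} → ((n : ℕ) → X n ⇒ Y n) → Stream X Y
  lift {X} {Y} fs = record { mem = λ _ → I ; act = a }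
    where
    a : (n : ℕ) → In (λ _ → I) X n ⇒ I ⊗₀ Y n
    a zero    = fs zero ⨾ lunit⁻¹
    a (suc n) = lunit ⨾ fs (suc n) ⨾ lunit⁻¹

  idₛ : ∀ X → Stream X X
  idₛ X = record { mem = λ _ → I ; act = a }
    where
    a : (n : ℕ) → In (λ _ → I) X n ⇒ I ⊗₀ X n
    a zero    = lunit⁻¹
    a (suc n) = id

  seqStep : ∀ {A B X₀ Y₀ Z₀ Mf Mg} →
            A ⊗₀ X₀ ⇒ Mf ⊗₀ Y₀ → B ⊗₀ Y₀ ⇒ Mg ⊗₀ Z₀ →
            (A ⊗₀ B) ⊗₀ X₀ ⇒ (Mf ⊗₀ Mg) ⊗₀ Z₀
  seqStep a b = swapMid ⨾ (a ⊗₁ id) ⨾ assoc ⨾ (id ⊗₁ braid) ⨾ (id ⊗₁ b) ⨾ assoc⁻¹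

  infixr 9 _⨾ₛ_
  _⨾ₛ_ : ∀ {X Y Z} → Stream X Y → Stream Y Z → Stream X Z
  _⨾ₛ_ {X} {Y} {Z} f g = record { mem = m ; act = a }
    where
    m : ℕ → Obj
    m n = mem f n ⊗₀ mem g n
    a : (n : ℕ) → In m X n ⇒ m n ⊗₀ Z n
    a zero    = act f zero ⨾ (id ⊗₁ act g zero) ⨾ assoc⁻¹
    a (suc n) = seqStep (act f (suc n)) (act g (suc n))

  exch : ∀ {A B C' D} → (A ⊗₀ B) ⊗₀ (C' ⊗₀ D) ⇒ (A ⊗₀ C') ⊗₀ (B ⊗₀ D)
  exch = assoc ⨾ (id ⊗₁ (assoc⁻¹ ⨾ (braid ⊗₁ id) ⨾ assoc)) ⨾ assoc⁻¹

  infixr 10 _⊗ₛ_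
  _⊗ₛ_ : ∀ {X Y X' Y'} → Stream X Y → Stream X' Y' → Stream (X ⊗ˢ X') (Y ⊗ˢ Y')
  _⊗ₛ_ {X} {Y} {X'} {Y'} f g = record { mem = m ; act = a }
    where
    m : ℕ → Obj
    m n = mem f n ⊗₀ mem g n
    a : (n : ℕ) → In m (X ⊗ˢ X') n ⇒ m n ⊗₀ (Y ⊗ˢ Y') n
    a zero    = (act f zero ⊗₁ act g zero) ⨾ exch
    a (suc n) = exch ⨾ (act f (suc n) ⊗₁ act g (suc n)) ⨾ exch

  ∂ₛ : ∀ {X Y} → Stream X Y → Stream (∂ X) (∂ Y)
  ∂ₛ {X} {Y} f = record { mem = m ; act = a }
    where
    m : ℕ → Obj
    m zero    = I
    m (suc n) = mem f n
    a : (n : ℕ) → In m (∂ X) n ⇒ m n ⊗₀ ∂ Y n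
    a zero          = lunit⁻¹
    a (suc zero)    = lunit ⨾ act f zero
    a (suc (suc n)) = act f (suc n)

  fbk : ∀ {S X Y} → Stream (∂ S ⊗ˢ X) (S ⊗ˢ Y) → Stream X Y
  fbk {S} {X} {Y} f = record { mem = m ; act = a }
    where
    m : ℕ → Obj
    m n = mem f n ⊗₀ S n
    a : (n : ℕ) → In m X n ⇒ m n ⊗₀ Y n
    a zero    = lunit⁻¹ ⨾ act f zero ⨾ assoc⁻¹
    a (suc n) = assoc ⨾ act f (suc n) ⨾ assoc⁻¹

  unitIn : ∀ X → Stream (∂ Iˢ ⊗ˢ X) X
  unitIn X = lift u
    where
    u : (n : ℕ) → (∂ Iˢ ⊗ˢ X) n ⇒ X n
    u zero    = lunit
    u (suc n) = lunit

  unitOut : ∀ Y → Stream Y (Iˢ ⊗ˢ Y)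
  unitOut Y = lift (λ n → lunit⁻¹)

  joinIn : ∀ S T X → Stream (∂ (S ⊗ˢ T) ⊗ˢ X) (∂ S ⊗ˢ (∂ T ⊗ˢ X))
  joinIn S T X = lift j
    where
    j : (n : ℕ) → (∂ (S ⊗ˢ T) ⊗ˢ X) n ⇒ (∂ S ⊗ˢ (∂ T ⊗ˢ X)) n
    j zero    = (lunit⁻¹ ⊗₁ id) ⨾ assoc
    j (suc n) = assoc

  joinOut : ∀ S T Y → Stream (S ⊗ˢ (T ⊗ˢ Y)) ((S ⊗ˢ T) ⊗ˢ Y)
  joinOut S T Y = lift (λ n → assoc⁻¹)

  assocˢ : ∀ X Y Z → Stream ((X ⊗ˢ Y) ⊗ˢ Z) (X ⊗ˢ (Y ⊗ˢ Z))
  assocˢ X Y Z = lift (λ n → assoc)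

  assocˢ⁻¹ : ∀ X Y Z → Stream (X ⊗ˢ (Y ⊗ˢ Z)) ((X ⊗ˢ Y) ⊗ˢ Z)
  assocˢ⁻¹ X Y Z = lift (λ n → assoc⁻¹)

  ∂-⊗ : ∀ X Y → Stream (∂ (X ⊗ˢ Y)) (∂ X ⊗ˢ ∂ Y)
  ∂-⊗ X Y = lift φ
    where
    φ : (n : ℕ) → ∂ (X ⊗ˢ Y) n ⇒ (∂ X ⊗ˢ ∂ Y) n
    φ zero    = lunit⁻¹
    φ (suc n) = id

  record IsFeedbackStream : Set₁ where
    field
      ∂-cong : ∀ {X Y} {f g : Stream X Y} → f ≈ₛ g → ∂ₛ f ≈ₛ ∂ₛ g
      ∂-id   : ∀ {X} → ∂ₛ (idₛ X) ≈ₛ idₛ (∂ X)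
      ∂-⨾    : ∀ {X Y Z} (f : Stream X Y) (g : Stream Y Z) →
               ∂ₛ (f ⨾ₛ g) ≈ₛ ∂ₛ f ⨾ₛ ∂ₛ g
      ∂-⊗-nat : ∀ {X Y X' Y'} (f : Stream X Y) (g : Stream X' Y') →
                ∂ₛ (f ⊗ₛ g) ⨾ₛ ∂-⊗ Y Y' ≈ₛ ∂-⊗ X X' ⨾ₛ (∂ₛ f ⊗ₛ ∂ₛ g)
      fbk-cong : ∀ {S X Y} {f g : Stream (∂ S ⊗ˢ X) (S ⊗ˢ Y)} →
                 f ≈ₛ g → fbk f ≈ₛ fbk g
      tightening : ∀ {S X X' Y Y'} (u : Stream X' X)
                   (f : Stream (∂ S ⊗ˢ X) (S ⊗ˢ Y)) (v : Stream Y Y') →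
                   (u ⨾ₛ fbk f) ⨾ₛ v ≈ₛ
                   fbk (((idₛ (∂ S) ⊗ₛ u) ⨾ₛ f) ⨾ₛ (idₛ S ⊗ₛ v))
      vanishing : ∀ {X Y} (f : Stream X Y) →
                  fbk {Iˢ} ((unitIn X ⨾ₛ f) ⨾ₛ unitOut Y) ≈ₛ f
      joining : ∀ {S T X Y} (f : Stream (∂ S ⊗ˢ (∂ T ⊗ˢ X)) (S ⊗ˢ (T ⊗ˢ Y))) →
                fbk {T} (fbk {S} f) ≈ₛ
                fbk {S ⊗ˢ T} ((joinIn S T X ⨾ₛ f) ⨾ₛ joinOut S T Y)
      strength : ∀ {S X Y X' Y'} (f : Stream (∂ S ⊗ˢ X) (S ⊗ˢ Y)) (g : Stream X' Y') →
                 fbk f ⊗ₛ g ≈ₛ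
                 fbk {S} ((assocˢ⁻¹ (∂ S) X X' ⨾ₛ (f ⊗ₛ g)) ⨾ₛ assocˢ S Y Y')
      sliding : ∀ {S T X Y} (h : Stream S T) (f : Stream (∂ T ⊗ˢ X) (S ⊗ˢ Y)) →
                fbk {S} ((∂ₛ h ⊗ₛ idₛ X) ⨾ₛ f) ≈ₛ fbk {T} (f ⨾ₛ (h ⊗ₛ idₛ Y))

-- Every equation required of a
-- feedback monoidal category is witnessed by a simulation between the two sides: a family of maps
-- between their memories, built from structural isomorphisms (and, for sliding, from the actions
-- of h), commuting with all actions. Each commuting square is an equation in C between composites
-- of structural isomorphisms and uninterpreted actions, which is decided by normalising both sides
-- into alternations of permutations of atoms and single actions. That ∂ and fbk respect _≈ₛ_ is an
-- up-to argument: closing a bisimulation under ∂ (resp. fbk) gives a bisimulation up to simulations.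

module Submission where

open import Level using (0ℓ)
open import Data.Empty using (⊥)
open import Data.List using (List; []; _∷_; _++_)
open import Data.Maybe using (Maybe; just; nothing)
open import Data.Nat using (ℕ; zero; suc)
open import Data.Product using (Σ; _,_; _×_)
open import Data.Sum using (_⊎_; inj₁; inj₂)
open import Relation.Binary using (IsEquivalence)
open import Relation.Binary.Bundles using (Setoid)
open import Relation.Binary.Construct.Closure.Equivalence using (EqClosure; gmap; map; symmetric)
open import Relation.Binary.Construct.Closure.ReflexiveTransitive using (ε; _◅_; _◅◅_)
open import Relation.Binary.Construct.Closure.Symmetric using (fwd; bwd)
open import Relation.Binary.PropositionalEquality using (_≡_; refl)
import Relation.Binary.Reasoning.Setoid as SetoidReasoning

open import Defs hiding (_⊗ˢ_; _·_; _·ₛ_; _⨾ₛ_; _⊗ₛ_; _≈ₛ_)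

module MonoidalReasoning (C : SymMonCat) where
  open SymMonCat C public

  hom-setoid : Obj → Obj → Setoid 0ℓ 0ℓ
  hom-setoid A B = record { isEquivalence = ≈-equiv {A} {B} }

  module ≈ {A B} = IsEquivalence (≈-equiv {A} {B})
  open module HomReasoning {A B} = SetoidReasoning (hom-setoid A B) public

  infixr 4 _⟩⨾⟨_ _⟩⊗⟨_

  _⟩⨾⟨_ : ∀ {A B C} {f f' : A ⇒ B} {g g' : B ⇒ C} → f ≈ f' → g ≈ g' → f ⨾ g ≈ f' ⨾ g'
  _⟩⨾⟨_ = ⨾-resp

  _⟩⊗⟨_ : ∀ {A B C D} {f f' : A ⇒ B} {g g' : C ⇒ D} → f ≈ f' → g ≈ g' → f ⊗₁ g ≈ f' ⊗₁ g'
  _⟩⊗⟨_ = ⊗-resp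

  ⨾-congˡ : ∀ {A B C} {f : A ⇒ B} {g g' : B ⇒ C} → g ≈ g' → f ⨾ g ≈ f ⨾ g'
  ⨾-congˡ p = ≈.refl ⟩⨾⟨ p

  ⨾-congʳ : ∀ {A B C} {f f' : A ⇒ B} {g : B ⇒ C} → f ≈ f' → f ⨾ g ≈ f' ⨾ g
  ⨾-congʳ p = p ⟩⨾⟨ ≈.refl

  pullˡ : ∀ {A B C D} {a : A ⇒ B} {b : B ⇒ C} {c : A ⇒ C} {r : C ⇒ D} →
          a ⨾ b ≈ c → a ⨾ (b ⨾ r) ≈ c ⨾ r
  pullˡ p = ≈.trans (≈.sym ⨾-assoc) (⨾-congʳ p)

  extendˡ : ∀ {A B C D E} {a : A ⇒ B} {b : B ⇒ D} {a' : A ⇒ C} {b' : C ⇒ D} {r : D ⇒ E} →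
            a ⨾ b ≈ a' ⨾ b' → a ⨾ (b ⨾ r) ≈ a' ⨾ (b' ⨾ r)
  extendˡ p = ≈.trans (≈.sym ⨾-assoc) (≈.trans (⨾-congʳ p) ⨾-assoc)

  prefix₁ : ∀ {A B C} {a : A ⇒ B} {r : B ⇒ C} → a ⨾ r ≈ a ⨾ r
  prefix₁ = ≈.refl

  prefix₂ : ∀ {A B C D} {a : A ⇒ B} {b : B ⇒ C} {r : C ⇒ D} → a ⨾ b ⨾ r ≈ (a ⨾ b) ⨾ r
  prefix₂ = ≈.sym ⨾-assoc

  prefix₃ : ∀ {A B C D E} {a : A ⇒ B} {b : B ⇒ C} {c : C ⇒ D} {r : D ⇒ E} →
            a ⨾ b ⨾ c ⨾ r ≈ (a ⨾ b ⨾ c) ⨾ r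
  prefix₃ = ≈.trans (⨾-congˡ prefix₂) (≈.sym ⨾-assoc)

  -- Rewrites the first k factors of a right-nested chain, given prefixₖ-style splittings of both sides.
  replace-prefix : ∀ {A B C} {X Y : A ⇒ B} {r : B ⇒ C} {Xr Yr : A ⇒ C} →
                   Xr ≈ X ⨾ r → Yr ≈ Y ⨾ r → X ≈ Y → Xr ≈ Yr
  replace-prefix p q e = ≈.trans p (≈.trans (⨾-congʳ e) (≈.sym q))

  cancelˡ : ∀ {A B C} {i : A ⇒ B} {j : B ⇒ A} {f g : B ⇒ C} →
            j ⨾ i ≈ id → i ⨾ f ≈ i ⨾ g → f ≈ g
  cancelˡ {i = i} {j} {f} {g} ji p = begin
    f ≈⟨ ⨾-idˡ ⟨
    id ⨾ f ≈⟨ ⨾-congʳ ji ⟨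
    (j ⨾ i) ⨾ f ≈⟨ ⨾-assoc ⟩
    j ⨾ i ⨾ f ≈⟨ ⨾-congˡ p ⟩
    j ⨾ i ⨾ g ≈⟨ ⨾-assoc ⟨
    (j ⨾ i) ⨾ g ≈⟨ ⨾-congʳ ji ⟩
    id ⨾ g ≈⟨ ⨾-idˡ ⟩
    g ∎

  cancelʳ : ∀ {A B C} {i : B ⇒ C} {j : C ⇒ B} {f g : A ⇒ B} →
            i ⨾ j ≈ id → f ⨾ i ≈ g ⨾ i → f ≈ g
  cancelʳ {i = i} {j} {f} {g} ij p = begin
    f ≈⟨ ⨾-idʳ ⟨
    f ⨾ id ≈⟨ ⨾-congˡ ij ⟨
    f ⨾ i ⨾ j ≈⟨ ⨾-assoc ⟨
    (f ⨾ i) ⨾ j ≈⟨ ⨾-congʳ p ⟩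
    (g ⨾ i) ⨾ j ≈⟨ ⨾-assoc ⟩
    g ⨾ i ⨾ j ≈⟨ ⨾-congˡ ij ⟩
    g ⨾ id ≈⟨ ⨾-idʳ ⟩
    g ∎

  conjugate : ∀ {A B A' B'} {α₁ : A ⇒ B} {β₁ : B ⇒ A} {α₂ : A' ⇒ B'} {β₂ : B' ⇒ A'}
                {a : A ⇒ A'} {b : B ⇒ B'} →
              β₁ ⨾ α₁ ≈ id → α₂ ⨾ β₂ ≈ id → a ⨾ α₂ ≈ α₁ ⨾ b → β₁ ⨾ a ≈ b ⨾ β₂
  conjugate {α₁ = α₁} {β₁} {α₂} {β₂} {a} {b} e1 e2 p = begin
    β₁ ⨾ a ≈⟨ ⨾-congˡ ⨾-idʳ ⟨
    β₁ ⨾ a ⨾ id ≈⟨ ⨾-congˡ (⨾-congˡ e2) ⟨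
    β₁ ⨾ a ⨾ α₂ ⨾ β₂ ≈⟨ ⨾-congˡ (extendˡ p) ⟩
    β₁ ⨾ α₁ ⨾ b ⨾ β₂ ≈⟨ pullˡ e1 ⟩
    id ⨾ b ⨾ β₂ ≈⟨ ⨾-idˡ ⟩
    b ⨾ β₂ ∎

  ⨾-⊗ : ∀ {A B C D E F} {f : A ⇒ B} {g : B ⇒ C} {h : D ⇒ E} {k : E ⇒ F} →
       (f ⊗₁ h) ⨾ (g ⊗₁ k) ≈ (f ⨾ g) ⊗₁ (h ⨾ k)
  ⨾-⊗ = ≈.sym ⊗-⨾

  ⨾-⊗id : ∀ {A B C D} {f : A ⇒ B} {g : B ⇒ C} → (f ⊗₁ id {D}) ⨾ (g ⊗₁ id) ≈ (f ⨾ g) ⊗₁ id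
  ⨾-⊗id = ≈.trans ⨾-⊗ (≈.refl ⟩⊗⟨ ⨾-idˡ)

  ⨾-id⊗ : ∀ {A B C D} {f : A ⇒ B} {g : B ⇒ C} → (id {D} ⊗₁ f) ⨾ (id ⊗₁ g) ≈ id ⊗₁ (f ⨾ g)
  ⨾-id⊗ = ≈.trans ⨾-⊗ (⨾-idˡ ⟩⊗⟨ ≈.refl)

  ⊗-splitˡ : ∀ {A B C D} {f : A ⇒ B} {g : C ⇒ D} → f ⊗₁ g ≈ (f ⊗₁ id) ⨾ (id ⊗₁ g)
  ⊗-splitˡ = ≈.trans (≈.sym ⨾-idʳ ⟩⊗⟨ ≈.sym ⨾-idˡ) ⊗-⨾

  ⊗-splitʳ : ∀ {A B C D} {f : A ⇒ B} {g : C ⇒ D} → f ⊗₁ g ≈ (id ⊗₁ g) ⨾ (f ⊗₁ id)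
  ⊗-splitʳ = ≈.trans (≈.sym ⨾-idˡ ⟩⊗⟨ ≈.sym ⨾-idʳ) ⊗-⨾

  assoc⁻¹-nat : ∀ {A B C D E F} {f : A ⇒ B} {g : C ⇒ D} {h : E ⇒ F} →
                (f ⊗₁ (g ⊗₁ h)) ⨾ assoc⁻¹ ≈ assoc⁻¹ ⨾ ((f ⊗₁ g) ⊗₁ h)
  assoc⁻¹-nat = ≈.sym (conjugate assoc-isoʳ assoc-isoˡ assoc-nat)

  ⊗id-iso : ∀ {A B C} {i : A ⇒ B} {j : B ⇒ A} → i ⨾ j ≈ id → (i ⊗₁ id {C}) ⨾ (j ⊗₁ id) ≈ id
  ⊗id-iso p = ≈.trans ⨾-⊗id (≈.trans (p ⟩⊗⟨ ≈.refl) ⊗-id)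

  id⊗-iso : ∀ {A B C} {i : A ⇒ B} {j : B ⇒ A} → i ⨾ j ≈ id → (id {C} ⊗₁ i) ⨾ (id ⊗₁ j) ≈ id
  id⊗-iso p = ≈.trans ⨾-id⊗ (≈.trans (≈.refl ⟩⊗⟨ p) ⊗-id)

  id⊗-faithful : ∀ {A B} {f g : A ⇒ B} → id {I} ⊗₁ f ≈ id ⊗₁ g → f ≈ g
  id⊗-faithful {f = f} {g} p = cancelˡ lunit-isoʳ (begin
    lunit ⨾ f ≈⟨ lunit-nat ⟨
    (id ⊗₁ f) ⨾ lunit ≈⟨ ⨾-congʳ p ⟩
    (id ⊗₁ g) ⨾ lunit ≈⟨ lunit-nat ⟩
    lunit ⨾ g ∎)

  ⊗id-faithful : ∀ {A B} {f g : A ⇒ B} → f ⊗₁ id {I} ≈ g ⊗₁ id → f ≈ g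
  ⊗id-faithful {f = f} {g} p = cancelˡ runit-isoʳ (begin
    runit ⨾ f ≈⟨ runit-nat ⟨
    (f ⊗₁ id) ⨾ runit ≈⟨ ⨾-congʳ p ⟩
    (g ⊗₁ id) ⨾ runit ≈⟨ runit-nat ⟩
    runit ⨾ g ∎)

  -- Kelly's lemmas: these unitor equations already follow from the triangle and the pentagon.
  assoc⨾lunit : ∀ {A B} → assoc {I} {A} {B} ⨾ lunit ≈ lunit ⊗₁ id
  assoc⨾lunit {A} {B} = id⊗-faithful (cancelˡ assoc-isoʳ (begin
      assoc ⨾ (id ⊗₁ (assoc ⨾ lunit))
        ≈⟨ cancelˡ {i = assoc ⊗₁ id} (⊗id-iso assoc-isoʳ) step ⟨
      ((id ⊗₁ lunit) ⊗₁ id) ⨾ assoc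
        ≈⟨ assoc-nat ⟩
      assoc ⨾ (id ⊗₁ (lunit ⊗₁ id)) ∎))
    where
    step : (assoc ⊗₁ id) ⨾ ((id ⊗₁ lunit) ⊗₁ id) ⨾ assoc ≈
           (assoc ⊗₁ id) ⨾ assoc ⨾ (id ⊗₁ (assoc {I} {A} {B} ⨾ lunit))
    step = begin
      (assoc {I} {I} {A} ⊗₁ id {B}) ⨾ ((id ⊗₁ lunit) ⊗₁ id) ⨾ assoc ≈⟨ pullˡ ⨾-⊗id ⟩
      ((assoc {I} {I} {A} ⨾ (id ⊗₁ lunit)) ⊗₁ id {B}) ⨾ assoc ≈⟨ ⨾-congʳ (triangle ⟩⊗⟨ ≈.refl) ⟩
      ((runit {I} ⊗₁ id {A}) ⊗₁ id {B}) ⨾ assoc ≈⟨ assoc-nat ⟩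
      assoc ⨾ (runit {I} ⊗₁ (id {A} ⊗₁ id {B})) ≈⟨ ⨾-congˡ (≈.refl ⟩⊗⟨ ⊗-id) ⟩
      assoc ⨾ (runit {I} ⊗₁ id {A ⊗₀ B}) ≈⟨ ⨾-congˡ triangle ⟨
      assoc ⨾ assoc ⨾ (id ⊗₁ lunit) ≈⟨ ≈.trans (pullˡ pentagon) ⨾-assoc ⟨
      (assoc ⊗₁ id) ⨾ (assoc ⨾ (id ⊗₁ assoc)) ⨾ (id ⊗₁ lunit) ≈⟨ ⨾-congˡ (≈.trans ⨾-assoc (⨾-congˡ ⨾-id⊗)) ⟩
      (assoc ⊗₁ id) ⨾ assoc ⨾ (id ⊗₁ (assoc ⨾ lunit)) ∎

  assoc⨾id⊗runit : ∀ {A B} → assoc {A} {B} {I} ⨾ (id ⊗₁ runit) ≈ runit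
  assoc⨾id⊗runit {A} {B} = ⊗id-faithful (cancelʳ assoc-isoˡ (begin
      ((assoc ⨾ (id ⊗₁ runit)) ⊗₁ id) ⨾ assoc ≈⟨ ⨾-congʳ ⨾-⊗id ⟨
      ((assoc ⊗₁ id) ⨾ ((id ⊗₁ runit) ⊗₁ id)) ⨾ assoc ≈⟨ ⨾-assoc ⟩
      (assoc ⊗₁ id) ⨾ ((id ⊗₁ runit) ⊗₁ id) ⨾ assoc ≈⟨ ⨾-congˡ assoc-nat ⟩
      (assoc ⊗₁ id) ⨾ assoc ⨾ (id ⊗₁ (runit ⊗₁ id)) ≈⟨ ⨾-congˡ (⨾-congˡ (≈.refl ⟩⊗⟨ triangle)) ⟨
      (assoc ⊗₁ id) ⨾ assoc ⨾ (id ⊗₁ (assoc ⨾ (id ⊗₁ lunit))) ≈⟨ ⨾-congˡ (⨾-congˡ ⨾-id⊗) ⟨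
      (assoc ⊗₁ id) ⨾ assoc ⨾ (id ⊗₁ assoc) ⨾ (id ⊗₁ (id ⊗₁ lunit))
        ≈⟨ ≈.trans (⨾-congˡ (≈.sym ⨾-assoc)) (≈.trans (≈.sym ⨾-assoc) (⨾-congʳ pentagon)) ⟩
      (assoc ⨾ assoc) ⨾ (id ⊗₁ (id ⊗₁ lunit)) ≈⟨ ⨾-assoc ⟩
      assoc ⨾ assoc ⨾ (id ⊗₁ (id ⊗₁ lunit)) ≈⟨ ⨾-congˡ assoc-nat ⟨
      assoc ⨾ ((id ⊗₁ id) ⊗₁ lunit) ⨾ assoc ≈⟨ ⨾-congˡ (⨾-congʳ (⊗-id ⟩⊗⟨ ≈.refl)) ⟩
      assoc ⨾ (id ⊗₁ lunit) ⨾ assoc ≈⟨ pullˡ triangle ⟩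
      (runit ⊗₁ id) ⨾ assoc ∎))

  lunit≈runit : lunit {I} ≈ runit {I}
  lunit≈runit = ⊗id-faithful (begin
      lunit ⊗₁ id ≈⟨ assoc⨾lunit ⟨
      assoc ⨾ lunit ≈⟨ ⨾-congˡ lunit≈id⊗lunit ⟩
      assoc ⨾ (id ⊗₁ lunit) ≈⟨ triangle ⟩
      runit ⊗₁ id ∎)
    where
    lunit≈id⊗lunit : lunit {I ⊗₀ I} ≈ id ⊗₁ lunit
    lunit≈id⊗lunit = ≈.sym (cancelʳ lunit-isoˡ lunit-nat)

  braid⨾lunit : ∀ {A} → braid {A} {I} ⨾ lunit ≈ runit
  braid⨾lunit {A} = ⊗id-faithful (cancelʳ braid-inv (begin
      ((braid ⨾ lunit) ⊗₁ id) ⨾ braid ≈⟨ ⨾-congʳ ⨾-⊗id ⟨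
      ((braid ⊗₁ id) ⨾ (lunit ⊗₁ id)) ⨾ braid ≈⟨ ⨾-assoc ⟩
      (braid ⊗₁ id) ⨾ (lunit ⊗₁ id) ⨾ braid ≈⟨ ⨾-congˡ (⨾-congʳ assoc⨾lunit) ⟨
      (braid ⊗₁ id) ⨾ (assoc ⨾ lunit) ⨾ braid ≈⟨ ⨾-congˡ ⨾-assoc ⟩
      (braid ⊗₁ id) ⨾ assoc ⨾ lunit ⨾ braid ≈⟨ ⨾-congˡ (⨾-congˡ lunit-nat) ⟨
      (braid ⊗₁ id) ⨾ assoc ⨾ (id ⊗₁ braid) ⨾ lunit ≈⟨ ≈.trans ⨾-assoc (⨾-congˡ ⨾-assoc) ⟨
      ((braid ⊗₁ id) ⨾ assoc ⨾ (id ⊗₁ braid)) ⨾ lunit ≈⟨ ⨾-congʳ hexagon ⟨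
      (assoc ⨾ braid ⨾ assoc) ⨾ lunit ≈⟨ ≈.trans ⨾-assoc (⨾-congˡ ⨾-assoc) ⟩
      assoc ⨾ braid ⨾ assoc ⨾ lunit ≈⟨ ⨾-congˡ (⨾-congˡ assoc⨾lunit) ⟩
      assoc ⨾ braid ⨾ (lunit ⊗₁ id) ≈⟨ ⨾-congˡ braid-nat ⟨
      assoc ⨾ (id ⊗₁ lunit) ⨾ braid ≈⟨ pullˡ triangle ⟩
      (runit ⊗₁ id) ⨾ braid ∎))

  inverse-unique : ∀ {A B} {X Y : A ⇒ B} {X' Y' : B ⇒ A} → X ⨾ X' ≈ id → Y' ⨾ Y ≈ id → X ≈ Y → X' ≈ Y'
  inverse-unique {X = X} {Y} {X'} {Y'} e1 e2 e = begin
    X' ≈⟨ ⨾-idˡ ⟨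
    id ⨾ X' ≈⟨ ⨾-congʳ e2 ⟨
    (Y' ⨾ Y) ⨾ X' ≈⟨ ⨾-assoc ⟩
    Y' ⨾ Y ⨾ X' ≈⟨ ⨾-congˡ (⨾-congʳ e) ⟨
    Y' ⨾ X ⨾ X' ≈⟨ ⨾-congˡ e1 ⟩
    Y' ⨾ id ≈⟨ ⨾-idʳ ⟩
    Y' ∎

module Transposition (C : SymMonCat) where
  open MonoidalReasoning C public

  τ : ∀ {x y Z} → x ⊗₀ (y ⊗₀ Z) ⇒ y ⊗₀ (x ⊗₀ Z)
  τ = assoc⁻¹ ⨾ (braid ⊗₁ id) ⨾ assoc

  τ-involutive : ∀ {x y Z} → τ {x} {y} {Z} ⨾ τ ≈ id
  τ-involutive = begin
    (assoc⁻¹ ⨾ (braid ⊗₁ id) ⨾ assoc) ⨾ assoc⁻¹ ⨾ (braid ⊗₁ id) ⨾ assoc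
      ≈⟨ ≈.trans ⨾-assoc (⨾-congˡ ⨾-assoc) ⟩
    assoc⁻¹ ⨾ (braid ⊗₁ id) ⨾ assoc ⨾ assoc⁻¹ ⨾ (braid ⊗₁ id) ⨾ assoc
      ≈⟨ ⨾-congˡ (⨾-congˡ (pullˡ assoc-isoˡ)) ⟩
    assoc⁻¹ ⨾ (braid ⊗₁ id) ⨾ id ⨾ (braid ⊗₁ id) ⨾ assoc
      ≈⟨ ⨾-congˡ (⨾-congˡ ⨾-idˡ) ⟩
    assoc⁻¹ ⨾ (braid ⊗₁ id) ⨾ (braid ⊗₁ id) ⨾ assoc
      ≈⟨ ⨾-congˡ (pullˡ (≈.trans ⨾-⊗id (≈.trans (braid-inv ⟩⊗⟨ ≈.refl) ⊗-id))) ⟩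
    assoc⁻¹ ⨾ id ⨾ assoc ≈⟨ ⨾-congˡ ⨾-idˡ ⟩
    assoc⁻¹ ⨾ assoc ≈⟨ assoc-isoʳ ⟩
    id ∎

  τ-natural : ∀ {A B C D E F} {f : A ⇒ B} {g : C ⇒ D} {h : E ⇒ F} →
          (f ⊗₁ (g ⊗₁ h)) ⨾ τ ≈ τ ⨾ (g ⊗₁ (f ⊗₁ h))
  τ-natural = begin
    _ ⨾ assoc⁻¹ ⨾ (braid ⊗₁ id) ⨾ assoc ≈⟨ pullˡ assoc⁻¹-nat ⟩
    (assoc⁻¹ ⨾ _) ⨾ (braid ⊗₁ id) ⨾ assoc ≈⟨ ⨾-assoc ⟩
    assoc⁻¹ ⨾ ((_ ⊗₁ _) ⊗₁ _) ⨾ (braid ⊗₁ id) ⨾ assoc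
      ≈⟨ ⨾-congˡ (pullˡ (≈.trans ⨾-⊗ (≈.trans (braid-nat ⟩⊗⟨ ≈.trans ⨾-idʳ (≈.sym ⨾-idˡ)) ⊗-⨾))) ⟩
    assoc⁻¹ ⨾ ((braid ⊗₁ id) ⨾ ((_ ⊗₁ _) ⊗₁ _)) ⨾ assoc ≈⟨ ⨾-congˡ (≈.trans ⨾-assoc (⨾-congˡ assoc-nat)) ⟩
    assoc⁻¹ ⨾ (braid ⊗₁ id) ⨾ assoc ⨾ _ ≈⟨ ≈.trans ⨾-assoc (⨾-congˡ ⨾-assoc) ⟨
    (assoc⁻¹ ⨾ (braid ⊗₁ id) ⨾ assoc) ⨾ _ ∎

  assoc⨾τ : ∀ {x y Z} → assoc ⨾ τ {x} {y} {Z} ≈ (braid ⊗₁ id) ⨾ assoc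
  assoc⨾τ = ≈.trans (pullˡ assoc-isoˡ) ⨾-idˡ

  assoc-nat-⊗id : ∀ {A B C D} {f : A ⇒ B} → assoc {A} {C} {D} ⨾ (f ⊗₁ id) ≈ ((f ⊗₁ id) ⊗₁ id) ⨾ assoc
  assoc-nat-⊗id = ≈.sym (≈.trans assoc-nat (⨾-congˡ (≈.refl ⟩⊗⟨ ⊗-id)))

  hexagon-⊗id : ∀ {x y z W} →
         ((braid {x} {y} ⊗₁ id {z}) ⊗₁ id {W}) ⨾ (assoc ⊗₁ id) ⨾ ((id ⊗₁ braid) ⊗₁ id) ≈
         (assoc ⊗₁ id) ⨾ (braid ⊗₁ id) ⨾ (assoc ⊗₁ id)
  hexagon-⊗id = begin
    _ ⨾ _ ⨾ _ ≈⟨ ⨾-congˡ ⨾-⊗id ⟩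
    _ ⨾ _ ≈⟨ ⨾-⊗id ⟩
    ((braid ⊗₁ id) ⨾ assoc ⨾ (id ⊗₁ braid)) ⊗₁ id ≈⟨ hexagon ⟩⊗⟨ ≈.refl ⟨
    (assoc ⨾ braid ⨾ assoc) ⊗₁ id ≈⟨ ⨾-⊗id ⟨
    _ ⨾ _ ≈⟨ ⨾-congˡ ⨾-⊗id ⟨
    _ ⨾ _ ⨾ _ ∎

  τ-assoc : ∀ {x y z W} →
       (id {x} ⊗₁ assoc {y} {z} {W}) ⨾ τ ⨾ (id ⊗₁ τ {x} {z} {W}) ≈ τ {x} {y ⊗₀ z} {W} ⨾ assoc
  τ-assoc {x} {y} {z} {W} = cancelˡ {i = (assoc {x} {y} {z} ⊗₁ id {W}) ⨾ assoc} inverse shifted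
    where
    inverse : (assoc⁻¹ ⨾ (assoc⁻¹ ⊗₁ id)) ⨾ ((assoc ⊗₁ id) ⨾ assoc) ≈ id
    inverse = ≈.trans ⨾-assoc (≈.trans (⨾-congˡ (pullˡ (⊗id-iso assoc-isoʳ))) (≈.trans (⨾-congˡ ⨾-idˡ) assoc-isoʳ))
    shifted : ((assoc ⊗₁ id) ⨾ assoc) ⨾ ((id ⊗₁ assoc) ⨾ τ ⨾ (id ⊗₁ τ)) ≈
           ((assoc ⊗₁ id) ⨾ assoc) ⨾ (τ ⨾ assoc)
    shifted = begin
      ((assoc ⊗₁ id) ⨾ assoc) ⨾ ((id ⊗₁ assoc) ⨾ τ ⨾ (id ⊗₁ τ)) ≈⟨ ⨾-assoc ⟩
      (assoc ⊗₁ id) ⨾ assoc ⨾ (id ⊗₁ assoc) ⨾ τ ⨾ (id ⊗₁ τ) ≈⟨ replace-prefix prefix₃ prefix₂ pentagon ⟩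
      assoc ⨾ assoc ⨾ τ ⨾ (id ⊗₁ τ) ≈⟨ ⨾-congˡ (replace-prefix prefix₂ prefix₂ assoc⨾τ) ⟩
      assoc ⨾ (braid ⊗₁ id) ⨾ assoc ⨾ (id ⊗₁ τ) ≈⟨ replace-prefix prefix₂ prefix₂ assoc-nat-⊗id ⟩
      ((braid ⊗₁ id) ⊗₁ id) ⨾ assoc ⨾ assoc ⨾ (id ⊗₁ τ)
        ≈⟨ ⨾-congˡ (replace-prefix prefix₂ prefix₃ (≈.sym pentagon)) ⟩
      ((braid ⊗₁ id) ⊗₁ id) ⨾ (assoc ⊗₁ id) ⨾ assoc ⨾ (id ⊗₁ assoc) ⨾ (id ⊗₁ τ)
        ≈⟨ ⨾-congˡ (⨾-congˡ (⨾-congˡ (≈.trans ⨾-id⊗ (≈.trans (≈.refl ⟩⊗⟨ assoc⨾τ) (≈.sym ⨾-id⊗))))) ⟩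
      ((braid ⊗₁ id) ⊗₁ id) ⨾ (assoc ⊗₁ id) ⨾ assoc ⨾ (id ⊗₁ (braid ⊗₁ id)) ⨾ (id ⊗₁ assoc)
        ≈⟨ ⨾-congˡ (⨾-congˡ (extendˡ (≈.sym assoc-nat))) ⟩
      ((braid ⊗₁ id) ⊗₁ id) ⨾ (assoc ⊗₁ id) ⨾ ((id ⊗₁ braid) ⊗₁ id) ⨾ assoc ⨾ (id ⊗₁ assoc)
        ≈⟨ replace-prefix prefix₃ prefix₃ hexagon-⊗id ⟩
      (assoc ⊗₁ id) ⨾ (braid ⊗₁ id) ⨾ (assoc ⊗₁ id) ⨾ assoc ⨾ (id ⊗₁ assoc) ≈⟨ ⨾-congˡ (⨾-congˡ pentagon) ⟩
      (assoc ⊗₁ id) ⨾ (braid ⊗₁ id) ⨾ assoc ⨾ assoc ≈⟨ ⨾-congˡ (replace-prefix prefix₂ prefix₂ assoc⨾τ) ⟨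
      (assoc ⊗₁ id) ⨾ assoc ⨾ τ ⨾ assoc ≈⟨ ⨾-assoc ⟨
      ((assoc ⊗₁ id) ⨾ assoc) ⨾ (τ ⨾ assoc) ∎

  τ-yang-baxter : ∀ {x y z W} →
       (id {x} ⊗₁ τ {y} {z} {W}) ⨾ τ ⨾ (id ⊗₁ τ) ≈ τ ⨾ (id ⊗₁ τ) ⨾ τ
  τ-yang-baxter = begin
    (id ⊗₁ τ) ⨾ τ ⨾ (id ⊗₁ τ)
      ≈⟨ ≈.trans (⨾-congʳ id⊗τ-unfold) (≈.trans ⨾-assoc (⨾-congˡ ⨾-assoc)) ⟩
    (id ⊗₁ assoc⁻¹) ⨾ (id ⊗₁ (braid ⊗₁ id)) ⨾ (id ⊗₁ assoc) ⨾ τ ⨾ (id ⊗₁ τ) ≈⟨ ⨾-congˡ (⨾-congˡ τ-assoc) ⟩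
    (id ⊗₁ assoc⁻¹) ⨾ (id ⊗₁ (braid ⊗₁ id)) ⨾ τ ⨾ assoc
      ≈⟨ ⨾-congˡ (replace-prefix prefix₂ prefix₂ (≈.trans τ-natural (⨾-congˡ (≈.refl ⟩⊗⟨ ⊗-id)))) ⟩
    (id ⊗₁ assoc⁻¹) ⨾ τ ⨾ (braid ⊗₁ id) ⨾ assoc ≈⟨ ⨾-congˡ (⨾-congˡ (≈.sym assoc⨾τ)) ⟩
    (id ⊗₁ assoc⁻¹) ⨾ τ ⨾ assoc ⨾ τ ≈⟨ ⨾-congˡ (replace-prefix prefix₂ prefix₃ (≈.sym τ-assoc)) ⟩
    (id ⊗₁ assoc⁻¹) ⨾ (id ⊗₁ assoc) ⨾ τ ⨾ (id ⊗₁ τ) ⨾ τ ≈⟨ pullˡ (id⊗-iso assoc-isoʳ) ⟩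
    id ⨾ τ ⨾ (id ⊗₁ τ) ⨾ τ ≈⟨ ⨾-idˡ ⟩
    τ ⨾ (id ⊗₁ τ) ⨾ τ ∎
    where
    id⊗τ-unfold : ∀ {a b c d} → id {a} ⊗₁ τ {b} {c} {d} ≈ (id ⊗₁ assoc⁻¹) ⨾ (id ⊗₁ (braid ⊗₁ id)) ⨾ (id ⊗₁ assoc)
    id⊗τ-unfold = ≈.trans (≈.sym ⨾-id⊗) (⨾-congˡ (≈.sym ⨾-id⊗))

  assoc⨾id⊗assoc⨾τ : ∀ {x y Z Y} →
       assoc {x} {y ⊗₀ Z} {Y} ⨾ (id ⊗₁ assoc) ⨾ τ ≈ (τ ⊗₁ id) ⨾ assoc ⨾ (id ⊗₁ assoc)
  assoc⨾id⊗assoc⨾τ = begin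
    assoc ⨾ (id ⊗₁ assoc) ⨾ τ ≈⟨ ≈.trans (pullˡ (⊗id-iso assoc-isoʳ)) ⨾-idˡ ⟨
    (assoc⁻¹ ⊗₁ id) ⨾ (assoc ⊗₁ id) ⨾ assoc ⨾ (id ⊗₁ assoc) ⨾ τ
      ≈⟨ ⨾-congˡ (replace-prefix prefix₃ prefix₂ pentagon) ⟩
    (assoc⁻¹ ⊗₁ id) ⨾ assoc ⨾ assoc ⨾ τ ≈⟨ ⨾-congˡ (⨾-congˡ assoc⨾τ) ⟩
    (assoc⁻¹ ⊗₁ id) ⨾ assoc ⨾ (braid ⊗₁ id) ⨾ assoc
      ≈⟨ ⨾-congˡ (replace-prefix prefix₂ prefix₂ assoc-nat-⊗id) ⟩
    (assoc⁻¹ ⊗₁ id) ⨾ ((braid ⊗₁ id) ⊗₁ id) ⨾ assoc ⨾ assoc ≈⟨ ⨾-congˡ (⨾-congˡ (≈.sym pentagon)) ⟩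
    (assoc⁻¹ ⊗₁ id) ⨾ ((braid ⊗₁ id) ⊗₁ id) ⨾ (assoc ⊗₁ id) ⨾ assoc ⨾ (id ⊗₁ assoc)
      ≈⟨ replace-prefix prefix₃ prefix₁ (≈.trans (⨾-congˡ ⨾-⊗id) ⨾-⊗id) ⟩
    (τ ⊗₁ id) ⨾ assoc ⨾ (id ⊗₁ assoc) ∎

  τ⨾lunit : ∀ {x Z} → τ {x} {I} {Z} ⨾ lunit ≈ id ⊗₁ lunit
  τ⨾lunit = begin
    (assoc⁻¹ ⨾ (braid ⊗₁ id) ⨾ assoc) ⨾ lunit
      ≈⟨ ≈.trans ⨾-assoc (⨾-congˡ (≈.trans ⨾-assoc (⨾-congˡ assoc⨾lunit))) ⟩
    assoc⁻¹ ⨾ (braid ⊗₁ id) ⨾ (lunit ⊗₁ id) ≈⟨ ⨾-congˡ (≈.trans ⨾-⊗id (braid⨾lunit ⟩⊗⟨ ≈.refl)) ⟩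
    assoc⁻¹ ⨾ (runit ⊗₁ id) ≈⟨ ⨾-congˡ triangle ⟨
    assoc⁻¹ ⨾ assoc ⨾ (id ⊗₁ lunit) ≈⟨ ≈.trans (pullˡ assoc-isoʳ) ⨾-idˡ ⟩
    id ⊗₁ lunit ∎

  braid-⊗ˡ : ∀ {A B C} → braid {A ⊗₀ B} {C} ≈ assoc ⨾ (id ⊗₁ braid) ⨾ τ
  braid-⊗ˡ {A} {B} {C} = begin
    braid
      ≈⟨ ≈.trans (⨾-congˡ ⨾-assoc)
           (≈.trans (pullˡ assoc-isoˡ) (≈.trans ⨾-idˡ (≈.trans ⨾-assoc (≈.trans (⨾-congˡ assoc-isoʳ) ⨾-idʳ)))) ⟨
    assoc {A} {B} {C} ⨾ (assoc⁻¹ {A} {B} {C} ⨾ braid {A ⊗₀ B} {C} ⨾ assoc⁻¹ {C} {A} {B}) ⨾ assoc {C} {A} {B}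
      ≈⟨ ⨾-congˡ (⨾-congʳ hexagon⁻¹) ⟩
    assoc ⨾ ((id ⊗₁ braid) ⨾ assoc⁻¹ ⨾ (braid ⊗₁ id)) ⨾ assoc ≈⟨ ⨾-congˡ (≈.trans ⨾-assoc (⨾-congˡ ⨾-assoc)) ⟩
    assoc ⨾ (id ⊗₁ braid) ⨾ τ ∎
    where
    braid-inverse : (assoc ⨾ braid ⨾ assoc) ⨾ (assoc⁻¹ ⨾ braid ⨾ assoc⁻¹) ≈ id
    braid-inverse = begin
      (assoc {C} {A} {B} ⨾ braid ⨾ assoc) ⨾ (assoc⁻¹ ⨾ braid ⨾ assoc⁻¹) ≈⟨ ≈.trans ⨾-assoc (⨾-congˡ ⨾-assoc) ⟩
      assoc ⨾ braid ⨾ assoc ⨾ assoc⁻¹ ⨾ braid ⨾ assoc⁻¹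
        ≈⟨ ⨾-congˡ (⨾-congˡ (≈.trans (pullˡ assoc-isoˡ) ⨾-idˡ)) ⟩
      assoc ⨾ braid ⨾ braid ⨾ assoc⁻¹ ≈⟨ ⨾-congˡ (≈.trans (pullˡ braid-inv) ⨾-idˡ) ⟩
      assoc ⨾ assoc⁻¹ ≈⟨ assoc-isoˡ ⟩ id ∎
    hexagon-inverse : ((id ⊗₁ braid) ⨾ assoc⁻¹ ⨾ (braid ⊗₁ id)) ⨾ ((braid ⊗₁ id) ⨾ assoc ⨾ (id ⊗₁ braid)) ≈ id
    hexagon-inverse = begin
      ((id ⊗₁ braid) ⨾ assoc⁻¹ ⨾ (braid ⊗₁ id)) ⨾ ((braid ⊗₁ id) ⨾ assoc ⨾ (id ⊗₁ braid))
        ≈⟨ ≈.trans ⨾-assoc (⨾-congˡ ⨾-assoc) ⟩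
      (id ⊗₁ braid) ⨾ assoc⁻¹ ⨾ (braid ⊗₁ id) ⨾ (braid ⊗₁ id) ⨾ assoc ⨾ (id ⊗₁ braid)
        ≈⟨ ⨾-congˡ (⨾-congˡ (≈.trans (pullˡ (⊗id-iso braid-inv)) ⨾-idˡ)) ⟩
      (id ⊗₁ braid) ⨾ assoc⁻¹ ⨾ assoc ⨾ (id ⊗₁ braid) ≈⟨ ⨾-congˡ (≈.trans (pullˡ assoc-isoʳ) ⨾-idˡ) ⟩
      (id ⊗₁ braid) ⨾ (id ⊗₁ braid) ≈⟨ id⊗-iso braid-inv ⟩ id ∎
    hexagon⁻¹ : assoc⁻¹ {A} {B} {C} ⨾ braid ⨾ assoc⁻¹ {C} {A} {B} ≈ (id ⊗₁ braid) ⨾ assoc⁻¹ ⨾ (braid ⊗₁ id)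
    hexagon⁻¹ = inverse-unique braid-inverse hexagon-inverse hexagon

module ListTensor (C : SymMonCat) where
  open Transposition C public

  ⨂ : List Obj → Obj
  ⨂ [] = I
  ⨂ (x ∷ xs) = x ⊗₀ ⨂ xs

  data Insert (x : Obj) : List Obj → List Obj → Set where
    here  : ∀ {zs} → Insert x zs (x ∷ zs)
    there : ∀ {y zs ys} → Insert x zs ys → Insert x (y ∷ zs) (y ∷ ys)

  infixr 5 _∷_
  data Perm : List Obj → List Obj → Set where
    [] : Perm [] []
    _∷_ : ∀ {x xs zs ys} → Insert x zs ys → Perm xs zs → Perm (x ∷ xs) ys

  ⟦_⟧ᴵ : ∀ {x zs ys} → Insert x zs ys → x ⊗₀ ⨂ zs ⇒ ⨂ ys
  ⟦ here ⟧ᴵ = id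
  ⟦ there i ⟧ᴵ = τ ⨾ (id ⊗₁ ⟦ i ⟧ᴵ)

  ⟦_⟧ᴾ : ∀ {xs ys} → Perm xs ys → ⨂ xs ⇒ ⨂ ys
  ⟦ [] ⟧ᴾ = id
  ⟦ i ∷ p ⟧ᴾ = (id ⊗₁ ⟦ p ⟧ᴾ) ⨾ ⟦ i ⟧ᴵ

  idᴾ : ∀ xs → Perm xs xs
  idᴾ [] = []
  idᴾ (x ∷ xs) = here ∷ idᴾ xs

  ⟦idᴾ⟧ : ∀ xs → ⟦ idᴾ xs ⟧ᴾ ≈ id
  ⟦idᴾ⟧ [] = ≈.refl
  ⟦idᴾ⟧ (x ∷ xs) = ≈.trans ⨾-idʳ (≈.trans (≈.refl ⟩⊗⟨ ⟦idᴾ⟧ xs) ⊗-id)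

  data Commuted (x y : Obj) (vs' ws : List Obj) : Set where
    commuted : ∀ {vs} → Insert y vs' vs → Insert x vs ws → Commuted x y vs' ws

  ⟦_⟧ᶜ : ∀ {x y vs' ws} → Commuted x y vs' ws → y ⊗₀ (x ⊗₀ ⨂ vs') ⇒ ⨂ ws
  ⟦ commuted k' j ⟧ᶜ = τ ⨾ (id ⊗₁ ⟦ k' ⟧ᴵ) ⨾ ⟦ j ⟧ᴵ

  commuted-there : ∀ {x y t vs₁ ws₁} → Commuted x y vs₁ ws₁ → Commuted x y (t ∷ vs₁) (t ∷ ws₁)
  commuted-there (commuted k₂ j₂) = commuted (there k₂) (there j₂)

  commute : ∀ {x y vs' ts ws} → Insert x vs' ts → Insert y ts ws → Commuted x y vs' ws
  commute j' here = commuted here (there j')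
  commute here (there k₁) = commuted k₁ here
  commute (there j₁) (there k₁) = commuted-there (commute j₁ k₁)

  ⟦commuted-there⟧ : ∀ {x y t vs₁ ts₁ ws₁}
                       (j₁ : Insert x vs₁ ts₁) (k₁ : Insert y ts₁ ws₁) (r : Commuted x y vs₁ ws₁) →
    (id ⊗₁ ⟦ j₁ ⟧ᴵ) ⨾ ⟦ k₁ ⟧ᴵ ≈ ⟦ r ⟧ᶜ →
    (id ⊗₁ ⟦ there {y = t} j₁ ⟧ᴵ) ⨾ ⟦ there k₁ ⟧ᴵ ≈ ⟦ commuted-there r ⟧ᶜ
  ⟦commuted-there⟧ j₁ k₁ (commuted k₂ j₂) ih = begin
    (id ⊗₁ (τ ⨾ (id ⊗₁ ⟦ j₁ ⟧ᴵ))) ⨾ τ ⨾ (id ⊗₁ ⟦ k₁ ⟧ᴵ) ≈⟨ ⨾-congʳ (≈.sym ⨾-id⊗) ⟩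
    ((id ⊗₁ τ) ⨾ (id ⊗₁ (id ⊗₁ ⟦ j₁ ⟧ᴵ))) ⨾ τ ⨾ (id ⊗₁ ⟦ k₁ ⟧ᴵ) ≈⟨ ⨾-assoc ⟩
    (id ⊗₁ τ) ⨾ (id ⊗₁ (id ⊗₁ ⟦ j₁ ⟧ᴵ)) ⨾ τ ⨾ (id ⊗₁ ⟦ k₁ ⟧ᴵ) ≈⟨ ⨾-congˡ (extendˡ τ-natural) ⟩
    (id ⊗₁ τ) ⨾ τ ⨾ (id ⊗₁ (id ⊗₁ ⟦ j₁ ⟧ᴵ)) ⨾ (id ⊗₁ ⟦ k₁ ⟧ᴵ) ≈⟨ ⨾-congˡ (⨾-congˡ ⨾-id⊗) ⟩
    (id ⊗₁ τ) ⨾ τ ⨾ (id ⊗₁ ((id ⊗₁ ⟦ j₁ ⟧ᴵ) ⨾ ⟦ k₁ ⟧ᴵ)) ≈⟨ ⨾-congˡ (⨾-congˡ (≈.refl ⟩⊗⟨ ih)) ⟩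
    (id ⊗₁ τ) ⨾ τ ⨾ (id ⊗₁ (τ ⨾ (id ⊗₁ ⟦ k₂ ⟧ᴵ) ⨾ ⟦ j₂ ⟧ᴵ))
      ≈⟨ ⨾-congˡ (⨾-congˡ (≈.trans (≈.sym ⨾-id⊗) (⨾-congˡ (≈.sym ⨾-id⊗)))) ⟩
    (id ⊗₁ τ) ⨾ τ ⨾ (id ⊗₁ τ) ⨾ (id ⊗₁ (id ⊗₁ ⟦ k₂ ⟧ᴵ)) ⨾ (id ⊗₁ ⟦ j₂ ⟧ᴵ)
      ≈⟨ replace-prefix prefix₃ prefix₃ τ-yang-baxter ⟩
    τ ⨾ (id ⊗₁ τ) ⨾ τ ⨾ (id ⊗₁ (id ⊗₁ ⟦ k₂ ⟧ᴵ)) ⨾ (id ⊗₁ ⟦ j₂ ⟧ᴵ)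
      ≈⟨ ⨾-congˡ (⨾-congˡ (extendˡ (≈.sym τ-natural))) ⟩
    τ ⨾ (id ⊗₁ τ) ⨾ (id ⊗₁ (id ⊗₁ ⟦ k₂ ⟧ᴵ)) ⨾ τ ⨾ (id ⊗₁ ⟦ j₂ ⟧ᴵ) ≈⟨ ⨾-congˡ (pullˡ ⨾-id⊗) ⟩
    τ ⨾ (id ⊗₁ (τ ⨾ (id ⊗₁ ⟦ k₂ ⟧ᴵ))) ⨾ τ ⨾ (id ⊗₁ ⟦ j₂ ⟧ᴵ) ∎

  ⟦commute⟧ : ∀ {x y vs' ts ws} (j' : Insert x vs' ts) (k : Insert y ts ws) →
    (id ⊗₁ ⟦ j' ⟧ᴵ) ⨾ ⟦ k ⟧ᴵ ≈ ⟦ commute j' k ⟧ᶜ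
  ⟦commute⟧ j' here = begin
    (id ⊗₁ ⟦ j' ⟧ᴵ) ⨾ id ≈⟨ ⨾-idʳ ⟩
    id ⊗₁ ⟦ j' ⟧ᴵ ≈⟨ ≈.trans (pullˡ τ-involutive) ⨾-idˡ ⟨
    τ ⨾ τ ⨾ (id ⊗₁ ⟦ j' ⟧ᴵ) ≈⟨ ⨾-congˡ ⨾-idˡ ⟨
    τ ⨾ id ⨾ τ ⨾ (id ⊗₁ ⟦ j' ⟧ᴵ) ≈⟨ ⨾-congˡ (⨾-congʳ ⊗-id) ⟨
    τ ⨾ (id ⊗₁ id) ⨾ τ ⨾ (id ⊗₁ ⟦ j' ⟧ᴵ) ∎
  ⟦commute⟧ here (there k₁) = begin
    (id ⊗₁ id) ⨾ τ ⨾ (id ⊗₁ ⟦ k₁ ⟧ᴵ) ≈⟨ ≈.trans (⨾-congʳ ⊗-id) ⨾-idˡ ⟩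
    τ ⨾ (id ⊗₁ ⟦ k₁ ⟧ᴵ) ≈⟨ ⨾-congˡ ⨾-idʳ ⟨
    τ ⨾ (id ⊗₁ ⟦ k₁ ⟧ᴵ) ⨾ id ∎
  ⟦commute⟧ (there j₁) (there k₁) = ⟦commuted-there⟧ j₁ k₁ (commute j₁ k₁) (⟦commute⟧ j₁ k₁)

  -- Composition of permutations transports each insertion of the first through the second:
  -- remove i q finds where the inserted element lands and how q permutes the others.
  data Removal (x : Obj) (zs ws : List Obj) : Set where
    removal : ∀ {vs} → Insert x vs ws → Perm zs vs → Removal x zs ws

  ⟦_⟧ᴿ : ∀ {x zs ws} → Removal x zs ws → x ⊗₀ ⨂ zs ⇒ ⨂ ws
  ⟦ removal j q' ⟧ᴿ = (id ⊗₁ ⟦ q' ⟧ᴾ) ⨾ ⟦ j ⟧ᴵ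

  removal-there : ∀ {x y zs' vs' ws} → Perm zs' vs' → Commuted x y vs' ws → Removal x (y ∷ zs') ws
  removal-there q'' (commuted k' j) = removal j (k' ∷ q'')

  remove-there : ∀ {x y zs' ts ws} → Insert y ts ws → Removal x zs' ts → Removal x (y ∷ zs') ws
  remove-there k (removal j' q'') = removal-there q'' (commute j' k)

  remove : ∀ {x zs ys ws} → Insert x zs ys → Perm ys ws → Removal x zs ws
  remove here (k ∷ q) = removal k q
  remove (there i) (k ∷ q) = remove-there k (remove i q)

  ⟦removal-there⟧ : ∀ {x y zs' vs' ts ws} (q'' : Perm zs' vs') (j' : Insert x vs' ts) (k : Insert y ts ws)
    (s : Commuted x y vs' ws) → (id ⊗₁ ⟦ j' ⟧ᴵ) ⨾ ⟦ k ⟧ᴵ ≈ ⟦ s ⟧ᶜ →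
    τ ⨾ (id ⊗₁ (id ⊗₁ ⟦ q'' ⟧ᴾ)) ⨾ (id ⊗₁ ⟦ j' ⟧ᴵ) ⨾ ⟦ k ⟧ᴵ ≈ ⟦ removal-there q'' s ⟧ᴿ
  ⟦removal-there⟧ q'' j' k (commuted k' j) e = begin
    τ ⨾ (id ⊗₁ (id ⊗₁ ⟦ q'' ⟧ᴾ)) ⨾ (id ⊗₁ ⟦ j' ⟧ᴵ) ⨾ ⟦ k ⟧ᴵ ≈⟨ ⨾-congˡ (⨾-congˡ e) ⟩
    τ ⨾ (id ⊗₁ (id ⊗₁ ⟦ q'' ⟧ᴾ)) ⨾ τ ⨾ (id ⊗₁ ⟦ k' ⟧ᴵ) ⨾ ⟦ j ⟧ᴵ ≈⟨ ⨾-congˡ (extendˡ τ-natural) ⟩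
    τ ⨾ τ ⨾ (id ⊗₁ (id ⊗₁ ⟦ q'' ⟧ᴾ)) ⨾ (id ⊗₁ ⟦ k' ⟧ᴵ) ⨾ ⟦ j ⟧ᴵ ≈⟨ ≈.trans (pullˡ τ-involutive) ⨾-idˡ ⟩
    (id ⊗₁ (id ⊗₁ ⟦ q'' ⟧ᴾ)) ⨾ (id ⊗₁ ⟦ k' ⟧ᴵ) ⨾ ⟦ j ⟧ᴵ ≈⟨ pullˡ ⨾-id⊗ ⟩
    (id ⊗₁ ((id ⊗₁ ⟦ q'' ⟧ᴾ) ⨾ ⟦ k' ⟧ᴵ)) ⨾ ⟦ j ⟧ᴵ ∎

  ⟦remove-there⟧ : ∀ {x y zs' ts ts' ws} (i : Insert x zs' ts') (q : Perm ts' ts) (k : Insert y ts ws)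
    (r : Removal x zs' ts) → ⟦ i ⟧ᴵ ⨾ ⟦ q ⟧ᴾ ≈ ⟦ r ⟧ᴿ →
    ⟦ there {y = y} i ⟧ᴵ ⨾ ⟦ k ∷ q ⟧ᴾ ≈ ⟦ remove-there k r ⟧ᴿ
  ⟦remove-there⟧ i q k (removal j' q'') e = begin
    (τ ⨾ (id ⊗₁ ⟦ i ⟧ᴵ)) ⨾ (id ⊗₁ ⟦ q ⟧ᴾ) ⨾ ⟦ k ⟧ᴵ ≈⟨ ≈.trans ⨾-assoc (⨾-congˡ (pullˡ ⨾-id⊗)) ⟩
    τ ⨾ (id ⊗₁ (⟦ i ⟧ᴵ ⨾ ⟦ q ⟧ᴾ)) ⨾ ⟦ k ⟧ᴵ ≈⟨ ⨾-congˡ (⨾-congʳ (≈.refl ⟩⊗⟨ e)) ⟩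
    τ ⨾ (id ⊗₁ ((id ⊗₁ ⟦ q'' ⟧ᴾ) ⨾ ⟦ j' ⟧ᴵ)) ⨾ ⟦ k ⟧ᴵ ≈⟨ ⨾-congˡ (≈.trans (⨾-congʳ (≈.sym ⨾-id⊗)) ⨾-assoc) ⟩
    τ ⨾ (id ⊗₁ (id ⊗₁ ⟦ q'' ⟧ᴾ)) ⨾ (id ⊗₁ ⟦ j' ⟧ᴵ) ⨾ ⟦ k ⟧ᴵ
      ≈⟨ ⟦removal-there⟧ q'' j' k (commute j' k) (⟦commute⟧ j' k) ⟩
    ⟦ removal-there q'' (commute j' k) ⟧ᴿ ∎

  ⟦remove⟧ : ∀ {x zs ys ws} (i : Insert x zs ys) (q : Perm ys ws) → ⟦ i ⟧ᴵ ⨾ ⟦ q ⟧ᴾ ≈ ⟦ remove i q ⟧ᴿ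
  ⟦remove⟧ here (k ∷ q) = ⨾-idˡ
  ⟦remove⟧ (there i) (k ∷ q) = ⟦remove-there⟧ i q k (remove i q) (⟦remove⟧ i q)

  infixr 9 _⨾ᴾ_
  mutual
    _⨾ᴾ_ : ∀ {xs ys ws} → Perm xs ys → Perm ys ws → Perm xs ws
    [] ⨾ᴾ [] = []
    (i ∷ p) ⨾ᴾ q = insert-removal p (remove i q)

    insert-removal : ∀ {x xs zs ws} → Perm xs zs → Removal x zs ws → Perm (x ∷ xs) ws
    insert-removal p (removal j q') = j ∷ (p ⨾ᴾ q')

  mutual
    ⟦⨾ᴾ⟧ : ∀ {xs ys ws} (p : Perm xs ys) (q : Perm ys ws) → ⟦ p ⨾ᴾ q ⟧ᴾ ≈ ⟦ p ⟧ᴾ ⨾ ⟦ q ⟧ᴾ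
    ⟦⨾ᴾ⟧ [] [] = ≈.sym ⨾-idˡ
    ⟦⨾ᴾ⟧ (i ∷ p) q = ≈.trans (⟦insert-removal⟧ p (remove i q)) (begin
      (id ⊗₁ ⟦ p ⟧ᴾ) ⨾ ⟦ remove i q ⟧ᴿ ≈⟨ ⨾-congˡ (⟦remove⟧ i q) ⟨
      (id ⊗₁ ⟦ p ⟧ᴾ) ⨾ ⟦ i ⟧ᴵ ⨾ ⟦ q ⟧ᴾ ≈⟨ ⨾-assoc ⟨
      ((id ⊗₁ ⟦ p ⟧ᴾ) ⨾ ⟦ i ⟧ᴵ) ⨾ ⟦ q ⟧ᴾ ∎)

    ⟦insert-removal⟧ : ∀ {x xs zs ws} (p : Perm xs zs) (r : Removal x zs ws) →
                       ⟦ insert-removal p r ⟧ᴾ ≈ (id ⊗₁ ⟦ p ⟧ᴾ) ⨾ ⟦ r ⟧ᴿ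
    ⟦insert-removal⟧ p (removal j q') = begin
      (id ⊗₁ ⟦ p ⨾ᴾ q' ⟧ᴾ) ⨾ ⟦ j ⟧ᴵ ≈⟨ ⨾-congʳ (≈.refl ⟩⊗⟨ ⟦⨾ᴾ⟧ p q') ⟩
      (id ⊗₁ (⟦ p ⟧ᴾ ⨾ ⟦ q' ⟧ᴾ)) ⨾ ⟦ j ⟧ᴵ ≈⟨ ≈.trans (⨾-congʳ (≈.sym ⨾-id⊗)) ⨾-assoc ⟩
      (id ⊗₁ ⟦ p ⟧ᴾ) ⨾ (id ⊗₁ ⟦ q' ⟧ᴾ) ⨾ ⟦ j ⟧ᴵ ∎

  ⨂-++ : ∀ xs ys → ⨂ xs ⊗₀ ⨂ ys ⇒ ⨂ (xs ++ ys)
  ⨂-++ [] ys = lunit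
  ⨂-++ (x ∷ xs) ys = assoc ⨾ (id ⊗₁ ⨂-++ xs ys)

  ⨂-++⁻¹ : ∀ xs ys → ⨂ (xs ++ ys) ⇒ ⨂ xs ⊗₀ ⨂ ys
  ⨂-++⁻¹ [] ys = lunit⁻¹
  ⨂-++⁻¹ (x ∷ xs) ys = (id ⊗₁ ⨂-++⁻¹ xs ys) ⨾ assoc⁻¹

  ⨂-++-isoˡ : ∀ xs ys → ⨂-++ xs ys ⨾ ⨂-++⁻¹ xs ys ≈ id
  ⨂-++-isoˡ [] ys = lunit-isoˡ
  ⨂-++-isoˡ (x ∷ xs) ys = begin
    (assoc ⨾ (id ⊗₁ ⨂-++ xs ys)) ⨾ (id ⊗₁ ⨂-++⁻¹ xs ys) ⨾ assoc⁻¹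
      ≈⟨ ≈.trans ⨾-assoc (⨾-congˡ (pullˡ (id⊗-iso (⨂-++-isoˡ xs ys)))) ⟩
    assoc ⨾ id ⨾ assoc⁻¹ ≈⟨ ≈.trans (⨾-congˡ ⨾-idˡ) assoc-isoˡ ⟩ id ∎

  ⨂-++-isoʳ : ∀ xs ys → ⨂-++⁻¹ xs ys ⨾ ⨂-++ xs ys ≈ id
  ⨂-++-isoʳ [] ys = lunit-isoʳ
  ⨂-++-isoʳ (x ∷ xs) ys = begin
    ((id ⊗₁ ⨂-++⁻¹ xs ys) ⨾ assoc⁻¹) ⨾ assoc ⨾ (id ⊗₁ ⨂-++ xs ys)
      ≈⟨ ≈.trans ⨾-assoc (⨾-congˡ (pullˡ assoc-isoʳ)) ⟩
    (id ⊗₁ ⨂-++⁻¹ xs ys) ⨾ id ⨾ (id ⊗₁ ⨂-++ xs ys)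
      ≈⟨ ≈.trans (⨾-congˡ ⨾-idˡ) (id⊗-iso (⨂-++-isoʳ xs ys)) ⟩ id ∎

  infixl 5 _++ᴵ_ _++ᴾ_
  _++ᴵ_ : ∀ {x zs ws} → Insert x zs ws → ∀ ys → Insert x (zs ++ ys) (ws ++ ys)
  here ++ᴵ ys = here
  there i ++ᴵ ys = there (i ++ᴵ ys)

  _++ᴾ_ : ∀ {xs zs} → Perm xs zs → ∀ ys → Perm (xs ++ ys) (zs ++ ys)
  [] ++ᴾ ys = idᴾ ys
  (i ∷ p) ++ᴾ ys = (i ++ᴵ ys) ∷ (p ++ᴾ ys)

  infixr 5 _++ˡ_
  _++ˡ_ : ∀ xs {ys ys'} → Perm ys ys' → Perm (xs ++ ys) (xs ++ ys')
  [] ++ˡ q = q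
  (x ∷ xs) ++ˡ q = here ∷ (xs ++ˡ q)

  infixr 6 _⊕ᴾ_
  _⊕ᴾ_ : ∀ {xs xs' ys ys'} → Perm xs xs' → Perm ys ys' → Perm (xs ++ ys) (xs' ++ ys')
  _⊕ᴾ_ {xs' = xs'} {ys = ys} p q = (p ++ᴾ ys) ⨾ᴾ (xs' ++ˡ q)

  ⨂-++-insert : ∀ {x zs ws} (i : Insert x zs ws) ys →
        assoc ⨾ (id ⊗₁ ⨂-++ zs ys) ⨾ ⟦ i ++ᴵ ys ⟧ᴵ ≈ (⟦ i ⟧ᴵ ⊗₁ id) ⨾ ⨂-++ ws ys
  ⨂-++-insert here ys = ≈.trans (⨾-congˡ ⨾-idʳ) (≈.sym (≈.trans (⨾-congʳ ⊗-id) ⨾-idˡ))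
  ⨂-++-insert (there {y} {zs} {ws} i) ys = begin
    assoc ⨾ (id ⊗₁ (assoc ⨾ (id ⊗₁ ⨂-++ zs ys))) ⨾ τ ⨾ (id ⊗₁ ⟦ i ++ᴵ ys ⟧ᴵ)
      ≈⟨ ⨾-congˡ (≈.trans (⨾-congʳ (≈.sym ⨾-id⊗)) ⨾-assoc) ⟩
    assoc ⨾ (id ⊗₁ assoc) ⨾ (id ⊗₁ (id ⊗₁ ⨂-++ zs ys)) ⨾ τ ⨾ (id ⊗₁ ⟦ i ++ᴵ ys ⟧ᴵ)
      ≈⟨ ⨾-congˡ (⨾-congˡ (extendˡ τ-natural)) ⟩
    assoc ⨾ (id ⊗₁ assoc) ⨾ τ ⨾ (id ⊗₁ (id ⊗₁ ⨂-++ zs ys)) ⨾ (id ⊗₁ ⟦ i ++ᴵ ys ⟧ᴵ)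
      ≈⟨ replace-prefix prefix₃ prefix₃ assoc⨾id⊗assoc⨾τ ⟩
    (τ ⊗₁ id) ⨾ assoc ⨾ (id ⊗₁ assoc) ⨾ (id ⊗₁ (id ⊗₁ ⨂-++ zs ys)) ⨾ (id ⊗₁ ⟦ i ++ᴵ ys ⟧ᴵ)
      ≈⟨ ⨾-congˡ (⨾-congˡ (≈.trans (⨾-congˡ ⨾-id⊗) ⨾-id⊗)) ⟩
    (τ ⊗₁ id) ⨾ assoc ⨾ (id ⊗₁ (assoc ⨾ (id ⊗₁ ⨂-++ zs ys) ⨾ ⟦ i ++ᴵ ys ⟧ᴵ))
      ≈⟨ ⨾-congˡ (⨾-congˡ (≈.refl ⟩⊗⟨ ⨂-++-insert i ys)) ⟩
    (τ ⊗₁ id) ⨾ assoc ⨾ (id ⊗₁ ((⟦ i ⟧ᴵ ⊗₁ id) ⨾ ⨂-++ ws ys)) ≈⟨ ⨾-congˡ (⨾-congˡ (≈.sym ⨾-id⊗)) ⟩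
    (τ ⊗₁ id) ⨾ assoc ⨾ (id ⊗₁ (⟦ i ⟧ᴵ ⊗₁ id)) ⨾ (id ⊗₁ ⨂-++ ws ys) ≈⟨ ⨾-congˡ (extendˡ (≈.sym assoc-nat)) ⟩
    (τ ⊗₁ id) ⨾ ((id ⊗₁ ⟦ i ⟧ᴵ) ⊗₁ id) ⨾ assoc ⨾ (id ⊗₁ ⨂-++ ws ys) ≈⟨ pullˡ ⨾-⊗id ⟩
    ((τ ⨾ (id ⊗₁ ⟦ i ⟧ᴵ)) ⊗₁ id) ⨾ assoc ⨾ (id ⊗₁ ⨂-++ ws ys) ∎

  ⨂-++-natˡ : ∀ {xs zs} (p : Perm xs zs) ys → ⨂-++ xs ys ⨾ ⟦ p ++ᴾ ys ⟧ᴾ ≈ (⟦ p ⟧ᴾ ⊗₁ id) ⨾ ⨂-++ zs ys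
  ⨂-++-natˡ [] ys = ≈.trans (≈.trans (⨾-congˡ (⟦idᴾ⟧ ys)) ⨾-idʳ) (≈.sym (≈.trans (⨾-congʳ ⊗-id) ⨾-idˡ))
  ⨂-++-natˡ {x ∷ xs} (_∷_ {zs = zs} {ys = ws} i p) ys = begin
    (assoc ⨾ (id ⊗₁ ⨂-++ xs ys)) ⨾ (id ⊗₁ ⟦ p ++ᴾ ys ⟧ᴾ) ⨾ ⟦ i ++ᴵ ys ⟧ᴵ
      ≈⟨ ≈.trans ⨾-assoc (⨾-congˡ (pullˡ ⨾-id⊗)) ⟩
    assoc ⨾ (id ⊗₁ (⨂-++ xs ys ⨾ ⟦ p ++ᴾ ys ⟧ᴾ)) ⨾ ⟦ i ++ᴵ ys ⟧ᴵ
      ≈⟨ ⨾-congˡ (⨾-congʳ (≈.refl ⟩⊗⟨ ⨂-++-natˡ p ys)) ⟩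
    assoc ⨾ (id ⊗₁ ((⟦ p ⟧ᴾ ⊗₁ id) ⨾ ⨂-++ zs ys)) ⨾ ⟦ i ++ᴵ ys ⟧ᴵ
      ≈⟨ ⨾-congˡ (≈.trans (⨾-congʳ (≈.sym ⨾-id⊗)) ⨾-assoc) ⟩
    assoc ⨾ (id ⊗₁ (⟦ p ⟧ᴾ ⊗₁ id)) ⨾ (id ⊗₁ ⨂-++ zs ys) ⨾ ⟦ i ++ᴵ ys ⟧ᴵ ≈⟨ extendˡ (≈.sym assoc-nat) ⟩
    ((id ⊗₁ ⟦ p ⟧ᴾ) ⊗₁ id) ⨾ assoc ⨾ (id ⊗₁ ⨂-++ zs ys) ⨾ ⟦ i ++ᴵ ys ⟧ᴵ ≈⟨ ⨾-congˡ (⨂-++-insert i ys) ⟩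
    ((id ⊗₁ ⟦ p ⟧ᴾ) ⊗₁ id) ⨾ (⟦ i ⟧ᴵ ⊗₁ id) ⨾ ⨂-++ ws ys ≈⟨ pullˡ ⨾-⊗id ⟩
    (((id ⊗₁ ⟦ p ⟧ᴾ) ⨾ ⟦ i ⟧ᴵ) ⊗₁ id) ⨾ ⨂-++ ws ys ∎

  ⨂-++-natʳ : ∀ xs {ys ys'} (q : Perm ys ys') → ⨂-++ xs ys ⨾ ⟦ xs ++ˡ q ⟧ᴾ ≈ (id ⊗₁ ⟦ q ⟧ᴾ) ⨾ ⨂-++ xs ys'
  ⨂-++-natʳ [] q = ≈.sym lunit-nat
  ⨂-++-natʳ (x ∷ xs) {ys} {ys'} q = begin
    (assoc ⨾ (id ⊗₁ ⨂-++ xs ys)) ⨾ (id ⊗₁ ⟦ xs ++ˡ q ⟧ᴾ) ⨾ id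
      ≈⟨ ≈.trans ⨾-assoc (⨾-congˡ (≈.trans (⨾-congˡ ⨾-idʳ) ⨾-id⊗)) ⟩
    assoc ⨾ (id ⊗₁ (⨂-++ xs ys ⨾ ⟦ xs ++ˡ q ⟧ᴾ)) ≈⟨ ⨾-congˡ (≈.refl ⟩⊗⟨ ⨂-++-natʳ xs q) ⟩
    assoc ⨾ (id ⊗₁ ((id ⊗₁ ⟦ q ⟧ᴾ) ⨾ ⨂-++ xs ys')) ≈⟨ ⨾-congˡ (≈.sym ⨾-id⊗) ⟩
    assoc ⨾ (id ⊗₁ (id ⊗₁ ⟦ q ⟧ᴾ)) ⨾ (id ⊗₁ ⨂-++ xs ys') ≈⟨ extendˡ (≈.sym assoc-nat) ⟩
    ((id ⊗₁ id) ⊗₁ ⟦ q ⟧ᴾ) ⨾ assoc ⨾ (id ⊗₁ ⨂-++ xs ys') ≈⟨ ⨾-congʳ (⊗-id ⟩⊗⟨ ≈.refl) ⟩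
    (id ⊗₁ ⟦ q ⟧ᴾ) ⨾ assoc ⨾ (id ⊗₁ ⨂-++ xs ys') ∎

  ⨂-++-natural : ∀ {xs xs' ys ys'} (p : Perm xs xs') (q : Perm ys ys') →
       ⨂-++ xs ys ⨾ ⟦ p ⊕ᴾ q ⟧ᴾ ≈ (⟦ p ⟧ᴾ ⊗₁ ⟦ q ⟧ᴾ) ⨾ ⨂-++ xs' ys'
  ⨂-++-natural {xs} {xs'} {ys} {ys'} p q = begin
    ⨂-++ xs ys ⨾ ⟦ (p ++ᴾ ys) ⨾ᴾ (xs' ++ˡ q) ⟧ᴾ ≈⟨ ⨾-congˡ (⟦⨾ᴾ⟧ (p ++ᴾ ys) (xs' ++ˡ q)) ⟩
    ⨂-++ xs ys ⨾ ⟦ p ++ᴾ ys ⟧ᴾ ⨾ ⟦ xs' ++ˡ q ⟧ᴾ ≈⟨ extendˡ (⨂-++-natˡ p ys) ⟩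
    (⟦ p ⟧ᴾ ⊗₁ id) ⨾ ⨂-++ xs' ys ⨾ ⟦ xs' ++ˡ q ⟧ᴾ ≈⟨ ⨾-congˡ (⨂-++-natʳ xs' q) ⟩
    (⟦ p ⟧ᴾ ⊗₁ id) ⨾ (id ⊗₁ ⟦ q ⟧ᴾ) ⨾ ⨂-++ xs' ys' ≈⟨ pullˡ (≈.trans ⨾-⊗ (⨾-idʳ ⟩⊗⟨ ⨾-idˡ)) ⟩
    (⟦ p ⟧ᴾ ⊗₁ ⟦ q ⟧ᴾ) ⨾ ⨂-++ xs' ys' ∎

  assocᴾ : ∀ xs ys zs → Perm ((xs ++ ys) ++ zs) (xs ++ (ys ++ zs))
  assocᴾ [] ys zs = idᴾ (ys ++ zs)
  assocᴾ (x ∷ xs) ys zs = here ∷ assocᴾ xs ys zs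

  assoc⁻¹ᴾ : ∀ xs ys zs → Perm (xs ++ (ys ++ zs)) ((xs ++ ys) ++ zs)
  assoc⁻¹ᴾ [] ys zs = idᴾ (ys ++ zs)
  assoc⁻¹ᴾ (x ∷ xs) ys zs = here ∷ assoc⁻¹ᴾ xs ys zs

  ⟦assocᴾ⟧-inverse : ∀ xs ys zs → ⟦ assocᴾ xs ys zs ⟧ᴾ ⨾ ⟦ assoc⁻¹ᴾ xs ys zs ⟧ᴾ ≈ id
  ⟦assocᴾ⟧-inverse [] ys zs = ≈.trans (⟦idᴾ⟧ (ys ++ zs) ⟩⨾⟨ ⟦idᴾ⟧ (ys ++ zs)) ⨾-idˡ
  ⟦assocᴾ⟧-inverse (x ∷ xs) ys zs = ≈.trans (⨾-idʳ ⟩⨾⟨ ⨾-idʳ) (id⊗-iso (⟦assocᴾ⟧-inverse xs ys zs))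

  ⨂-++-assoc : ∀ xs ys zs → (⨂-++ xs ys ⊗₁ id) ⨾ ⨂-++ (xs ++ ys) zs ⨾ ⟦ assocᴾ xs ys zs ⟧ᴾ ≈
                      assoc ⨾ (id ⊗₁ ⨂-++ ys zs) ⨾ ⨂-++ xs (ys ++ zs)
  ⨂-++-assoc [] ys zs = begin
    (lunit ⊗₁ id) ⨾ ⨂-++ ys zs ⨾ ⟦ idᴾ (ys ++ zs) ⟧ᴾ ≈⟨ ⨾-congˡ (≈.trans (⨾-congˡ (⟦idᴾ⟧ (ys ++ zs))) ⨾-idʳ) ⟩
    (lunit ⊗₁ id) ⨾ ⨂-++ ys zs ≈⟨ ⨾-congʳ assoc⨾lunit ⟨
    (assoc ⨾ lunit) ⨾ ⨂-++ ys zs ≈⟨ ⨾-assoc ⟩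
    assoc ⨾ lunit ⨾ ⨂-++ ys zs ≈⟨ ⨾-congˡ lunit-nat ⟨
    assoc ⨾ (id ⊗₁ ⨂-++ ys zs) ⨾ lunit ∎
  ⨂-++-assoc (x ∷ xs) ys zs = begin
    ((assoc ⨾ (id ⊗₁ ⨂-++ xs ys)) ⊗₁ id) ⨾ (assoc ⨾ (id ⊗₁ ⨂-++ (xs ++ ys) zs)) ⨾ (id ⊗₁ ⟦ assocᴾ xs ys zs ⟧ᴾ) ⨾ id
      ≈⟨ ≈.trans (⨾-congʳ (≈.sym ⨾-⊗id))
           (≈.trans ⨾-assoc (⨾-congˡ (⨾-congˡ (≈.trans ⨾-assoc (⨾-congˡ (⨾-congˡ ⨾-idʳ)))))) ⟩
    (assoc ⊗₁ id) ⨾ ((id ⊗₁ ⨂-++ xs ys) ⊗₁ id) ⨾ assoc ⨾ (id ⊗₁ ⨂-++ (xs ++ ys) zs) ⨾ (id ⊗₁ ⟦ assocᴾ xs ys zs ⟧ᴾ)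
      ≈⟨ ⨾-congˡ (extendˡ assoc-nat) ⟩
    (assoc ⊗₁ id) ⨾ assoc ⨾ (id ⊗₁ (⨂-++ xs ys ⊗₁ id)) ⨾ (id ⊗₁ ⨂-++ (xs ++ ys) zs) ⨾ (id ⊗₁ ⟦ assocᴾ xs ys zs ⟧ᴾ)
      ≈⟨ ⨾-congˡ (⨾-congˡ (≈.trans (⨾-congˡ ⨾-id⊗) ⨾-id⊗)) ⟩
    (assoc ⊗₁ id) ⨾ assoc ⨾ (id ⊗₁ ((⨂-++ xs ys ⊗₁ id) ⨾ ⨂-++ (xs ++ ys) zs ⨾ ⟦ assocᴾ xs ys zs ⟧ᴾ))
      ≈⟨ ⨾-congˡ (⨾-congˡ (≈.refl ⟩⊗⟨ ⨂-++-assoc xs ys zs)) ⟩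
    (assoc ⊗₁ id) ⨾ assoc ⨾ (id ⊗₁ (assoc ⨾ (id ⊗₁ ⨂-++ ys zs) ⨾ ⨂-++ xs (ys ++ zs)))
      ≈⟨ ⨾-congˡ (⨾-congˡ (≈.trans (≈.sym ⨾-id⊗) (⨾-congˡ (≈.sym ⨾-id⊗)))) ⟩
    (assoc ⊗₁ id) ⨾ assoc ⨾ (id ⊗₁ assoc) ⨾ (id ⊗₁ (id ⊗₁ ⨂-++ ys zs)) ⨾ (id ⊗₁ ⨂-++ xs (ys ++ zs))
      ≈⟨ replace-prefix prefix₃ prefix₂ pentagon ⟩
    assoc ⨾ assoc ⨾ (id ⊗₁ (id ⊗₁ ⨂-++ ys zs)) ⨾ (id ⊗₁ ⨂-++ xs (ys ++ zs))
      ≈⟨ ⨾-congˡ (extendˡ (≈.sym assoc-nat)) ⟩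
    assoc ⨾ ((id ⊗₁ id) ⊗₁ ⨂-++ ys zs) ⨾ assoc ⨾ (id ⊗₁ ⨂-++ xs (ys ++ zs))
      ≈⟨ ⨾-congˡ (⨾-congʳ (⊗-id ⟩⊗⟨ ≈.refl)) ⟩
    assoc ⨾ (id ⊗₁ ⨂-++ ys zs) ⨾ assoc ⨾ (id ⊗₁ ⨂-++ xs (ys ++ zs)) ∎

  runitᴾ : ∀ xs → Perm (xs ++ []) xs
  runitᴾ [] = []
  runitᴾ (x ∷ xs) = here ∷ runitᴾ xs

  runit⁻¹ᴾ : ∀ xs → Perm xs (xs ++ [])
  runit⁻¹ᴾ [] = []
  runit⁻¹ᴾ (x ∷ xs) = here ∷ runit⁻¹ᴾ xs

  ⟦runitᴾ⟧-inverse : ∀ xs → ⟦ runitᴾ xs ⟧ᴾ ⨾ ⟦ runit⁻¹ᴾ xs ⟧ᴾ ≈ id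
  ⟦runitᴾ⟧-inverse [] = ⨾-idˡ
  ⟦runitᴾ⟧-inverse (x ∷ xs) = ≈.trans (⨾-idʳ ⟩⨾⟨ ⨾-idʳ) (id⊗-iso (⟦runitᴾ⟧-inverse xs))

  ⨂-++-runit : ∀ xs → ⨂-++ xs [] ⨾ ⟦ runitᴾ xs ⟧ᴾ ≈ runit
  ⨂-++-runit [] = ≈.trans ⨾-idʳ lunit≈runit
  ⨂-++-runit (x ∷ xs) = begin
    (assoc ⨾ (id ⊗₁ ⨂-++ xs [])) ⨾ (id ⊗₁ ⟦ runitᴾ xs ⟧ᴾ) ⨾ id
      ≈⟨ ≈.trans ⨾-assoc (⨾-congˡ (≈.trans (⨾-congˡ ⨾-idʳ) ⨾-id⊗)) ⟩
    assoc ⨾ (id ⊗₁ (⨂-++ xs [] ⨾ ⟦ runitᴾ xs ⟧ᴾ)) ≈⟨ ⨾-congˡ (≈.refl ⟩⊗⟨ ⨂-++-runit xs) ⟩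
    assoc ⨾ (id ⊗₁ runit) ≈⟨ assoc⨾id⊗runit ⟩
    runit ∎

  ⨂-++-runit⁻¹ : ∀ xs → ⨂-++ xs [] ≈ runit ⨾ ⟦ runit⁻¹ᴾ xs ⟧ᴾ
  ⨂-++-runit⁻¹ xs = begin
    ⨂-++ xs [] ≈⟨ ≈.trans (⨾-congˡ (⟦runitᴾ⟧-inverse xs)) ⨾-idʳ ⟨
    ⨂-++ xs [] ⨾ ⟦ runitᴾ xs ⟧ᴾ ⨾ ⟦ runit⁻¹ᴾ xs ⟧ᴾ ≈⟨ pullˡ (⨂-++-runit xs) ⟩
    runit ⨾ ⟦ runit⁻¹ᴾ xs ⟧ᴾ ∎

  insert-after : ∀ {x} ys {zs} → Insert x (ys ++ zs) (ys ++ x ∷ zs)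
  insert-after [] = here
  insert-after (y ∷ ys) = there (insert-after ys)

  ⨂-++-insert-after : ∀ {x} ys zs → (id ⊗₁ ⨂-++ ys zs) ⨾ ⟦ insert-after {x} ys {zs} ⟧ᴵ ≈ τ ⨾ ⨂-++ ys (x ∷ zs)
  ⨂-++-insert-after [] zs = ≈.trans ⨾-idʳ (≈.sym τ⨾lunit)
  ⨂-++-insert-after (y ∷ ys) zs = begin
    (id ⊗₁ (assoc ⨾ (id ⊗₁ ⨂-++ ys zs))) ⨾ τ ⨾ (id ⊗₁ ⟦ insert-after ys ⟧ᴵ)
      ≈⟨ ≈.trans (⨾-congʳ (≈.sym ⨾-id⊗)) ⨾-assoc ⟩
    (id ⊗₁ assoc) ⨾ (id ⊗₁ (id ⊗₁ ⨂-++ ys zs)) ⨾ τ ⨾ (id ⊗₁ ⟦ insert-after ys ⟧ᴵ)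
      ≈⟨ ⨾-congˡ (extendˡ τ-natural) ⟩
    (id ⊗₁ assoc) ⨾ τ ⨾ (id ⊗₁ (id ⊗₁ ⨂-++ ys zs)) ⨾ (id ⊗₁ ⟦ insert-after ys ⟧ᴵ) ≈⟨ ⨾-congˡ (⨾-congˡ ⨾-id⊗) ⟩
    (id ⊗₁ assoc) ⨾ τ ⨾ (id ⊗₁ ((id ⊗₁ ⨂-++ ys zs) ⨾ ⟦ insert-after ys ⟧ᴵ))
      ≈⟨ ⨾-congˡ (⨾-congˡ (≈.refl ⟩⊗⟨ ⨂-++-insert-after ys zs)) ⟩
    (id ⊗₁ assoc) ⨾ τ ⨾ (id ⊗₁ (τ ⨾ ⨂-++ ys (_ ∷ zs))) ≈⟨ ⨾-congˡ (⨾-congˡ (≈.sym ⨾-id⊗)) ⟩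
    (id ⊗₁ assoc) ⨾ τ ⨾ (id ⊗₁ τ) ⨾ (id ⊗₁ ⨂-++ ys (_ ∷ zs)) ≈⟨ replace-prefix prefix₃ prefix₂ τ-assoc ⟩
    τ ⨾ assoc ⨾ (id ⊗₁ ⨂-++ ys (_ ∷ zs)) ∎

  braidᴾ : ∀ xs ys → Perm (xs ++ ys) (ys ++ xs)
  braidᴾ [] ys = runit⁻¹ᴾ ys
  braidᴾ (x ∷ xs) ys = insert-after ys ∷ braidᴾ xs ys

  ⨂-++-braid : ∀ xs ys → ⨂-++ xs ys ⨾ ⟦ braidᴾ xs ys ⟧ᴾ ≈ braid ⨾ ⨂-++ ys xs
  ⨂-++-braid [] ys = begin
    lunit ⨾ ⟦ runit⁻¹ᴾ ys ⟧ᴾ ≈⟨ ⨾-congʳ braid⨾runit ⟨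
    (braid ⨾ runit) ⨾ ⟦ runit⁻¹ᴾ ys ⟧ᴾ ≈⟨ ⨾-assoc ⟩
    braid ⨾ runit ⨾ ⟦ runit⁻¹ᴾ ys ⟧ᴾ ≈⟨ ⨾-congˡ (⨂-++-runit⁻¹ ys) ⟨
    braid ⨾ ⨂-++ ys [] ∎
    where
    braid⨾runit : braid ⨾ runit ≈ lunit
    braid⨾runit = begin
      braid ⨾ runit ≈⟨ ⨾-congˡ braid⨾lunit ⟨
      braid ⨾ braid ⨾ lunit ≈⟨ ≈.trans (pullˡ braid-inv) ⨾-idˡ ⟩
      lunit ∎
  ⨂-++-braid (x ∷ xs) ys = begin
    (assoc ⨾ (id ⊗₁ ⨂-++ xs ys)) ⨾ (id ⊗₁ ⟦ braidᴾ xs ys ⟧ᴾ) ⨾ ⟦ insert-after ys ⟧ᴵ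
      ≈⟨ ≈.trans ⨾-assoc (⨾-congˡ (pullˡ ⨾-id⊗)) ⟩
    assoc ⨾ (id ⊗₁ (⨂-++ xs ys ⨾ ⟦ braidᴾ xs ys ⟧ᴾ)) ⨾ ⟦ insert-after ys ⟧ᴵ
      ≈⟨ ⨾-congˡ (⨾-congʳ (≈.refl ⟩⊗⟨ ⨂-++-braid xs ys)) ⟩
    assoc ⨾ (id ⊗₁ (braid ⨾ ⨂-++ ys xs)) ⨾ ⟦ insert-after ys ⟧ᴵ
      ≈⟨ ⨾-congˡ (≈.trans (⨾-congʳ (≈.sym ⨾-id⊗)) ⨾-assoc) ⟩
    assoc ⨾ (id ⊗₁ braid) ⨾ (id ⊗₁ ⨂-++ ys xs) ⨾ ⟦ insert-after ys ⟧ᴵ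
      ≈⟨ ⨾-congˡ (⨾-congˡ (⨂-++-insert-after ys xs)) ⟩
    assoc ⨾ (id ⊗₁ braid) ⨾ τ ⨾ ⨂-++ ys (x ∷ xs) ≈⟨ replace-prefix prefix₃ prefix₁ (≈.sym braid-⊗ˡ) ⟩
    braid ⨾ ⨂-++ ys (x ∷ xs) ∎

module Coherence (C : SymMonCat) where
  open ListTensor C public

  infixr 6 _⊕_
  data Ob : Set where
    `_ : Obj → Ob
    𝟙 : Ob
    _⊕_ : Ob → Ob → Ob

  ⟪_⟫ : Ob → Obj
  ⟪ ` x ⟫ = x
  ⟪ 𝟙 ⟫ = I
  ⟪ A ⊕ B ⟫ = ⟪ A ⟫ ⊗₀ ⟪ B ⟫

  atoms : Ob → List Obj
  atoms (` x) = x ∷ []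
  atoms 𝟙 = []
  atoms (A ⊕ B) = atoms A ++ atoms B

  flatten : ∀ A → ⟪ A ⟫ ⇒ ⨂ (atoms A)
  flatten (` x) = runit⁻¹
  flatten 𝟙 = id
  flatten (A ⊕ B) = (flatten A ⊗₁ flatten B) ⨾ ⨂-++ (atoms A) (atoms B)

  unflatten : ∀ A → ⨂ (atoms A) ⇒ ⟪ A ⟫
  unflatten (` x) = runit
  unflatten 𝟙 = id
  unflatten (A ⊕ B) = ⨂-++⁻¹ (atoms A) (atoms B) ⨾ (unflatten A ⊗₁ unflatten B)

  flatten-isoˡ : ∀ A → flatten A ⨾ unflatten A ≈ id
  flatten-isoˡ (` x) = runit-isoʳ
  flatten-isoˡ 𝟙 = ⨾-idˡ
  flatten-isoˡ (A ⊕ B) = begin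
    ((flatten A ⊗₁ flatten B) ⨾ ⨂-++ (atoms A) (atoms B)) ⨾ ⨂-++⁻¹ (atoms A) (atoms B) ⨾ (unflatten A ⊗₁ unflatten B)
      ≈⟨ ≈.trans ⨾-assoc (⨾-congˡ (pullˡ (⨂-++-isoˡ (atoms A) (atoms B)))) ⟩
    (flatten A ⊗₁ flatten B) ⨾ id ⨾ (unflatten A ⊗₁ unflatten B) ≈⟨ ≈.trans (⨾-congˡ ⨾-idˡ) ⨾-⊗ ⟩
    (flatten A ⨾ unflatten A) ⊗₁ (flatten B ⨾ unflatten B)
      ≈⟨ ≈.trans (flatten-isoˡ A ⟩⊗⟨ flatten-isoˡ B) ⊗-id ⟩
    id ∎

  flatten-isoʳ : ∀ A → unflatten A ⨾ flatten A ≈ id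
  flatten-isoʳ (` x) = runit-isoˡ
  flatten-isoʳ 𝟙 = ⨾-idˡ
  flatten-isoʳ (A ⊕ B) = begin
    (⨂-++⁻¹ (atoms A) (atoms B) ⨾ (unflatten A ⊗₁ unflatten B)) ⨾ (flatten A ⊗₁ flatten B) ⨾ ⨂-++ (atoms A) (atoms B)
      ≈⟨ ≈.trans ⨾-assoc (⨾-congˡ (pullˡ ⨾-⊗)) ⟩
    ⨂-++⁻¹ (atoms A) (atoms B) ⨾ ((unflatten A ⨾ flatten A) ⊗₁ (unflatten B ⨾ flatten B)) ⨾ ⨂-++ (atoms A) (atoms B)
      ≈⟨ ⨾-congˡ (⨾-congʳ (≈.trans (flatten-isoʳ A ⟩⊗⟨ flatten-isoʳ B) ⊗-id)) ⟩
    ⨂-++⁻¹ (atoms A) (atoms B) ⨾ id ⨾ ⨂-++ (atoms A) (atoms B)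
      ≈⟨ ≈.trans (⨾-congˡ ⨾-idˡ) (⨂-++-isoʳ (atoms A) (atoms B)) ⟩
    id ∎

  Shuffle : Ob → Ob → Set
  Shuffle A B = Perm (atoms A) (atoms B)

  shuffle : ∀ A B → Shuffle A B → ⟪ A ⟫ ⇒ ⟪ B ⟫
  shuffle A B p = flatten A ⨾ ⟦ p ⟧ᴾ ⨾ unflatten B

  shuffle-⨾ : ∀ {A B C} (p : Shuffle A B) (q : Shuffle B C) → shuffle A C (p ⨾ᴾ q) ≈ shuffle A B p ⨾ shuffle B C q
  shuffle-⨾ {A} {B} {C} p q = begin
    flatten A ⨾ ⟦ p ⨾ᴾ q ⟧ᴾ ⨾ unflatten C ≈⟨ ⨾-congˡ (⨾-congʳ (⟦⨾ᴾ⟧ p q)) ⟩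
    flatten A ⨾ (⟦ p ⟧ᴾ ⨾ ⟦ q ⟧ᴾ) ⨾ unflatten C ≈⟨ ⨾-congˡ ⨾-assoc ⟩
    flatten A ⨾ ⟦ p ⟧ᴾ ⨾ ⟦ q ⟧ᴾ ⨾ unflatten C ≈⟨ ⨾-congˡ (⨾-congˡ (≈.trans (pullˡ (flatten-isoʳ B)) ⨾-idˡ)) ⟨
    flatten A ⨾ ⟦ p ⟧ᴾ ⨾ unflatten B ⨾ flatten B ⨾ ⟦ q ⟧ᴾ ⨾ unflatten C ≈⟨ prefix₃ ⟩
    (flatten A ⨾ ⟦ p ⟧ᴾ ⨾ unflatten B) ⨾ flatten B ⨾ ⟦ q ⟧ᴾ ⨾ unflatten C ∎

  shuffle-id : ∀ A → shuffle A A (idᴾ (atoms A)) ≈ id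
  shuffle-id A = ≈.trans (⨾-congˡ (≈.trans (⨾-congʳ (⟦idᴾ⟧ (atoms A))) ⨾-idˡ)) (flatten-isoˡ A)

  shuffle-split : ∀ {A A' B B'} (π : Shuffle (A ⊕ B) (A' ⊕ B'))
                    {P : ⨂ (atoms A) ⇒ ⨂ (atoms A')} {Q : ⨂ (atoms B) ⇒ ⨂ (atoms B')} →
                  ⨂-++ (atoms A) (atoms B) ⨾ ⟦ π ⟧ᴾ ≈ (P ⊗₁ Q) ⨾ ⨂-++ (atoms A') (atoms B') →
                  shuffle (A ⊕ B) (A' ⊕ B') π ≈ (flatten A ⨾ P ⨾ unflatten A') ⊗₁ (flatten B ⨾ Q ⨾ unflatten B')
  shuffle-split {A} {A'} {B} {B'} π {P} {Q} π-split = begin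
    ((flatten A ⊗₁ flatten B) ⨾ ⨂-++ a b) ⨾ ⟦ π ⟧ᴾ ⨾ ⨂-++⁻¹ a' b' ⨾ (unflatten A' ⊗₁ unflatten B')
      ≈⟨ ≈.trans ⨾-assoc (⨾-congˡ (replace-prefix prefix₂ prefix₂ π-split)) ⟩
    (flatten A ⊗₁ flatten B) ⨾ (P ⊗₁ Q) ⨾ ⨂-++ a' b' ⨾ ⨂-++⁻¹ a' b' ⨾ (unflatten A' ⊗₁ unflatten B')
      ≈⟨ ⨾-congˡ (⨾-congˡ (≈.trans (pullˡ (⨂-++-isoˡ a' b')) ⨾-idˡ)) ⟩
    (flatten A ⊗₁ flatten B) ⨾ (P ⊗₁ Q) ⨾ (unflatten A' ⊗₁ unflatten B')
      ≈⟨ ≈.trans (⨾-congˡ ⨾-⊗) ⨾-⊗ ⟩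
    (flatten A ⨾ P ⨾ unflatten A') ⊗₁ (flatten B ⨾ Q ⨾ unflatten B') ∎
    where
    a = atoms A
    b = atoms B
    a' = atoms A'
    b' = atoms B'

  shuffle-⊕ : ∀ {A A' B B'} (p : Shuffle A A') (q : Shuffle B B') →
              shuffle (A ⊕ B) (A' ⊕ B') (p ⊕ᴾ q) ≈ shuffle A A' p ⊗₁ shuffle B B' q
  shuffle-⊕ {A} {A'} {B} {B'} p q = shuffle-split {A} {A'} {B} {B'} (p ⊕ᴾ q) (⨂-++-natural p q)

  shuffle-++ˡ : ∀ {D R R'} (q : Shuffle R R') → shuffle (D ⊕ R) (D ⊕ R') (atoms D ++ˡ q) ≈ id ⊗₁ shuffle R R' q
  shuffle-++ˡ {D} {R} {R'} q =
    ≈.trans (shuffle-split {D} {D} {R} {R'} (atoms D ++ˡ q) (⨂-++-natʳ (atoms D) q))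
            (≈.trans (⨾-congˡ ⨾-idˡ) (flatten-isoˡ D) ⟩⊗⟨ ≈.refl)

  shuffle-⨾-inverse : ∀ {A B} (p : Shuffle A B) (q : Shuffle B A) →
                      ⟦ p ⟧ᴾ ⨾ ⟦ q ⟧ᴾ ≈ id → shuffle A B p ⨾ shuffle B A q ≈ id
  shuffle-⨾-inverse {A} {B} p q e = begin
    (flatten A ⨾ ⟦ p ⟧ᴾ ⨾ unflatten B) ⨾ flatten B ⨾ ⟦ q ⟧ᴾ ⨾ unflatten A
      ≈⟨ ≈.trans ⨾-assoc (⨾-congˡ (≈.trans ⨾-assoc (⨾-congˡ (≈.trans (pullˡ (flatten-isoʳ B)) ⨾-idˡ)))) ⟩
    flatten A ⨾ ⟦ p ⟧ᴾ ⨾ ⟦ q ⟧ᴾ ⨾ unflatten A ≈⟨ ⨾-congˡ (≈.trans (pullˡ e) ⨾-idˡ) ⟩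
    flatten A ⨾ unflatten A ≈⟨ flatten-isoˡ A ⟩ id ∎

  inverse≈shuffle : ∀ A B {f : ⟪ A ⟫ ⇒ ⟪ B ⟫} {g : ⟪ B ⟫ ⇒ ⟪ A ⟫} (p : Shuffle A B) (q : Shuffle B A) →
                    f ≈ shuffle A B p → ⟦ p ⟧ᴾ ⨾ ⟦ q ⟧ᴾ ≈ id → g ⨾ f ≈ id → g ≈ shuffle B A q
  inverse≈shuffle A B p q f≈p pq≈id gf≈id =
    ≈.sym (inverse-unique (shuffle-⨾-inverse {A} {B} p q pq≈id) gf≈id (≈.sym f≈p))

  assoc≈shuffle : ∀ {A B C} →
                  assoc {⟪ A ⟫} {⟪ B ⟫} {⟪ C ⟫} ≈
                  shuffle ((A ⊕ B) ⊕ C) (A ⊕ (B ⊕ C)) (assocᴾ (atoms A) (atoms B) (atoms C))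
  assoc≈shuffle {A} {B} {C} = ≈.sym (begin
    ((((flatten A ⊗₁ flatten B) ⨾ ⨂-++ a b) ⊗₁ flatten C) ⨾ ⨂-++ (a ++ b) c) ⨾
      ⟦ assocᴾ a b c ⟧ᴾ ⨾ unflatten (A ⊕ (B ⊕ C))
      ≈⟨ ≈.trans ⨾-assoc (⨾-congʳ (≈.trans (≈.refl ⟩⊗⟨ ≈.sym ⨾-idʳ) ⊗-⨾)) ⟩
    (((flatten A ⊗₁ flatten B) ⊗₁ flatten C) ⨾ (⨂-++ a b ⊗₁ id)) ⨾
      ⨂-++ (a ++ b) c ⨾ ⟦ assocᴾ a b c ⟧ᴾ ⨾ unflatten (A ⊕ (B ⊕ C))
      ≈⟨ ≈.trans ⨾-assoc (⨾-congˡ (replace-prefix prefix₃ prefix₃ (⨂-++-assoc a b c))) ⟩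
    ((flatten A ⊗₁ flatten B) ⊗₁ flatten C) ⨾ assoc ⨾ (id ⊗₁ ⨂-++ b c) ⨾ ⨂-++ a (b ++ c) ⨾ unflatten (A ⊕ (B ⊕ C))
      ≈⟨ extendˡ assoc-nat ⟩
    assoc ⨾ (flatten A ⊗₁ (flatten B ⊗₁ flatten C)) ⨾ (id ⊗₁ ⨂-++ b c) ⨾ ⨂-++ a (b ++ c) ⨾ unflatten (A ⊕ (B ⊕ C))
      ≈⟨ ⨾-congˡ (pullˡ (≈.trans ⨾-⊗ (⨾-idʳ ⟩⊗⟨ ≈.refl))) ⟩
    assoc ⨾ (flatten A ⊗₁ ((flatten B ⊗₁ flatten C) ⨾ ⨂-++ b c)) ⨾ ⨂-++ a (b ++ c) ⨾ unflatten (A ⊕ (B ⊕ C))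
      ≈⟨ ⨾-congˡ (≈.trans (≈.sym ⨾-assoc) (flatten-isoˡ (A ⊕ (B ⊕ C)))) ⟩
    assoc ⨾ id ≈⟨ ⨾-idʳ ⟩
    assoc ∎)
    where
    a = atoms A
    b = atoms B
    c = atoms C

  assoc⁻¹≈shuffle : ∀ {A B C} →
                    assoc⁻¹ {⟪ A ⟫} {⟪ B ⟫} {⟪ C ⟫} ≈
                    shuffle (A ⊕ (B ⊕ C)) ((A ⊕ B) ⊕ C) (assoc⁻¹ᴾ (atoms A) (atoms B) (atoms C))
  assoc⁻¹≈shuffle {A} {B} {C} =
    inverse≈shuffle ((A ⊕ B) ⊕ C) (A ⊕ (B ⊕ C)) (assocᴾ a b c) (assoc⁻¹ᴾ a b c)
                    (assoc≈shuffle {A} {B} {C}) (⟦assocᴾ⟧-inverse a b c) assoc-isoʳ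
    where
    a = atoms A
    b = atoms B
    c = atoms C

  lunit≈shuffle : ∀ {A} → lunit {⟪ A ⟫} ≈ shuffle (𝟙 ⊕ A) A (idᴾ (atoms A))
  lunit≈shuffle {A} = ≈.sym (begin
    ((id ⊗₁ flatten A) ⨾ lunit) ⨾ ⟦ idᴾ (atoms A) ⟧ᴾ ⨾ unflatten A
      ≈⟨ ≈.trans ⨾-assoc (⨾-congˡ (⨾-congˡ (≈.trans (⨾-congʳ (⟦idᴾ⟧ (atoms A))) ⨾-idˡ))) ⟩
    (id ⊗₁ flatten A) ⨾ lunit ⨾ unflatten A ≈⟨ extendˡ lunit-nat ⟩
    lunit ⨾ flatten A ⨾ unflatten A ≈⟨ ≈.trans (⨾-congˡ (flatten-isoˡ A)) ⨾-idʳ ⟩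
    lunit ∎)

  lunit⁻¹≈shuffle : ∀ {A} → lunit⁻¹ {⟪ A ⟫} ≈ shuffle A (𝟙 ⊕ A) (idᴾ (atoms A))
  lunit⁻¹≈shuffle {A} =
    inverse≈shuffle (𝟙 ⊕ A) A (idᴾ (atoms A)) (idᴾ (atoms A))
                    (lunit≈shuffle {A}) (≈.trans (⟦idᴾ⟧ (atoms A) ⟩⨾⟨ ⟦idᴾ⟧ (atoms A)) ⨾-idˡ) lunit-isoʳ

  runit≈shuffle : ∀ {A} → runit {⟪ A ⟫} ≈ shuffle (A ⊕ 𝟙) A (runitᴾ (atoms A))
  runit≈shuffle {A} = ≈.sym (begin
    ((flatten A ⊗₁ id) ⨾ ⨂-++ (atoms A) []) ⨾ ⟦ runitᴾ (atoms A) ⟧ᴾ ⨾ unflatten A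
      ≈⟨ ≈.trans ⨾-assoc (⨾-congˡ (pullˡ (⨂-++-runit (atoms A)))) ⟩
    (flatten A ⊗₁ id) ⨾ runit ⨾ unflatten A ≈⟨ extendˡ runit-nat ⟩
    runit ⨾ flatten A ⨾ unflatten A ≈⟨ ≈.trans (⨾-congˡ (flatten-isoˡ A)) ⨾-idʳ ⟩
    runit ∎)

  runit⁻¹≈shuffle : ∀ {A} → runit⁻¹ {⟪ A ⟫} ≈ shuffle A (A ⊕ 𝟙) (runit⁻¹ᴾ (atoms A))
  runit⁻¹≈shuffle {A} =
    inverse≈shuffle (A ⊕ 𝟙) A (runitᴾ (atoms A)) (runit⁻¹ᴾ (atoms A))
                    (runit≈shuffle {A}) (⟦runitᴾ⟧-inverse (atoms A)) runit-isoʳ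

  braid≈shuffle : ∀ {A B} → braid {⟪ A ⟫} {⟪ B ⟫} ≈ shuffle (A ⊕ B) (B ⊕ A) (braidᴾ (atoms A) (atoms B))
  braid≈shuffle {A} {B} = ≈.sym (begin
    ((flatten A ⊗₁ flatten B) ⨾ ⨂-++ (atoms A) (atoms B)) ⨾ ⟦ braidᴾ (atoms A) (atoms B) ⟧ᴾ ⨾ unflatten (B ⊕ A)
      ≈⟨ ≈.trans ⨾-assoc (⨾-congˡ (pullˡ (⨂-++-braid (atoms A) (atoms B)))) ⟩
    (flatten A ⊗₁ flatten B) ⨾ (braid ⨾ ⨂-++ (atoms B) (atoms A)) ⨾ unflatten (B ⊕ A) ≈⟨ ⨾-congˡ ⨾-assoc ⟩
    (flatten A ⊗₁ flatten B) ⨾ braid ⨾ ⨂-++ (atoms B) (atoms A) ⨾ unflatten (B ⊕ A) ≈⟨ extendˡ braid-nat ⟩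
    braid ⨾ (flatten B ⊗₁ flatten A) ⨾ ⨂-++ (atoms B) (atoms A) ⨾ unflatten (B ⊕ A)
      ≈⟨ ⨾-congˡ (≈.trans (≈.sym ⨾-assoc) (flatten-isoˡ (B ⊕ A))) ⟩
    braid ⨾ id ≈⟨ ⨾-idʳ ⟩ braid ∎)

  id≈shuffle : ∀ {A} → id {⟪ A ⟫} ≈ shuffle A A (idᴾ (atoms A))
  id≈shuffle {A} = ≈.sym (shuffle-id A)

  τᴾ : ∀ Q D R → Shuffle (Q ⊕ (D ⊕ R)) (D ⊕ (Q ⊕ R))
  τᴾ Q D R = assoc⁻¹ᴾ (atoms Q) (atoms D) (atoms R)
          ⨾ᴾ (braidᴾ (atoms Q) (atoms D) ⊕ᴾ idᴾ (atoms R))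
          ⨾ᴾ assocᴾ (atoms D) (atoms Q) (atoms R)

  τ≈shuffle : ∀ Q D R → τ {⟪ Q ⟫} {⟪ D ⟫} {⟪ R ⟫} ≈ shuffle (Q ⊕ (D ⊕ R)) (D ⊕ (Q ⊕ R)) (τᴾ Q D R)
  τ≈shuffle Q D R = begin
    assoc⁻¹ ⨾ (braid ⊗₁ id) ⨾ assoc
      ≈⟨ assoc⁻¹≈shuffle {Q} {D} {R} ⟩⨾⟨ braid⊗id≈shuffle ⟩⨾⟨ assoc≈shuffle {D} {Q} {R} ⟩
    shuffle (Q ⊕ (D ⊕ R)) ((Q ⊕ D) ⊕ R) a' ⨾
      shuffle ((Q ⊕ D) ⊕ R) ((D ⊕ Q) ⊕ R) (sw ⊕ᴾ idᴾ (atoms R)) ⨾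
      shuffle ((D ⊕ Q) ⊕ R) (D ⊕ (Q ⊕ R)) a
      ≈⟨ ⨾-congˡ (shuffle-⨾ {(Q ⊕ D) ⊕ R} {(D ⊕ Q) ⊕ R} {D ⊕ (Q ⊕ R)} (sw ⊕ᴾ idᴾ (atoms R)) a) ⟨
    shuffle (Q ⊕ (D ⊕ R)) ((Q ⊕ D) ⊕ R) a' ⨾ shuffle ((Q ⊕ D) ⊕ R) (D ⊕ (Q ⊕ R)) ((sw ⊕ᴾ idᴾ (atoms R)) ⨾ᴾ a)
      ≈⟨ shuffle-⨾ {Q ⊕ (D ⊕ R)} {(Q ⊕ D) ⊕ R} {D ⊕ (Q ⊕ R)} a' ((sw ⊕ᴾ idᴾ (atoms R)) ⨾ᴾ a) ⟨
    shuffle (Q ⊕ (D ⊕ R)) (D ⊕ (Q ⊕ R)) (τᴾ Q D R) ∎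
    where
    a' = assoc⁻¹ᴾ (atoms Q) (atoms D) (atoms R)
    sw = braidᴾ (atoms Q) (atoms D)
    a = assocᴾ (atoms D) (atoms Q) (atoms R)
    braid⊗id≈shuffle : braid ⊗₁ id ≈ shuffle ((Q ⊕ D) ⊕ R) ((D ⊕ Q) ⊕ R) (sw ⊕ᴾ idᴾ (atoms R))
    braid⊗id≈shuffle = ≈.trans (braid≈shuffle {Q} {D} ⟩⊗⟨ id≈shuffle {R})
                               (≈.sym (shuffle-⊕ {Q ⊕ D} {D ⊕ Q} {R} {R} sw (idᴾ (atoms R))))

  -- Normal forms alternate shuffles with a single box acting on the front wires D, the remaining
  -- wires R passing alongside.
  data NF (A B : Ob) : Set where
    done : Shuffle A B → NF A B
    apply : ∀ {D E R} → Shuffle A (D ⊕ R) → (⟪ D ⟫ ⇒ ⟪ E ⟫) → NF (E ⊕ R) B → NF A B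

  ⟦_⟧ᴺ : ∀ {A B} → NF A B → ⟪ A ⟫ ⇒ ⟪ B ⟫
  ⟦_⟧ᴺ {A} {B} (done p) = shuffle A B p
  ⟦_⟧ᴺ {A} {B} (apply {D} {E} {R} p f n) = shuffle A (D ⊕ R) p ⨾ (f ⊗₁ id) ⨾ ⟦ n ⟧ᴺ

  precompose : ∀ {A A' B} → Shuffle A A' → NF A' B → NF A B
  precompose q (done p) = done (q ⨾ᴾ p)
  precompose q (apply {D} {E} {R} p f n) = apply {D = D} {E} {R} (q ⨾ᴾ p) f n

  ⟦precompose⟧ : ∀ {A A' B} (q : Shuffle A A') (n : NF A' B) → ⟦ precompose {A} {A'} q n ⟧ᴺ ≈ shuffle A A' q ⨾ ⟦ n ⟧ᴺ
  ⟦precompose⟧ {A} {A'} {B} q (done p) = shuffle-⨾ {A} {A'} {B} q p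
  ⟦precompose⟧ {A} {A'} {B} q (apply {D} {E} {R} p f n) = ≈.trans (⨾-congʳ (shuffle-⨾ {A} {A'} {D ⊕ R} q p)) ⨾-assoc

  infixr 5 _++ᴺ_
  _++ᴺ_ : ∀ {A B C} → NF A B → NF B C → NF A C
  done p ++ᴺ m = precompose p m
  apply {D} {E} {R} p f n ++ᴺ m = apply {D = D} {E} {R} p f (n ++ᴺ m)

  ⟦++ᴺ⟧ : ∀ {A B C} (n : NF A B) (m : NF B C) → ⟦ n ++ᴺ m ⟧ᴺ ≈ ⟦ n ⟧ᴺ ⨾ ⟦ m ⟧ᴺ
  ⟦++ᴺ⟧ (done p) m = ⟦precompose⟧ p m
  ⟦++ᴺ⟧ {A} (apply {D} {E} {R} p f n) m =
    ≈.trans (⨾-congˡ (⨾-congˡ (⟦++ᴺ⟧ n m)))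
            (prefix₃ {a = shuffle A (D ⊕ R) p} {b = f ⊗₁ id} {c = ⟦ n ⟧ᴺ} {r = ⟦ m ⟧ᴺ})

  nf-⊗id : ∀ {A B} → NF A B → ∀ Q → NF (A ⊕ Q) (B ⊕ Q)
  nf-⊗id (done p) Q = done (p ⊕ᴾ idᴾ (atoms Q))
  nf-⊗id (apply {D} {E} {R} p f n) Q =
    apply {D = D} {E} {R ⊕ Q} ((p ⊕ᴾ idᴾ (atoms Q)) ⨾ᴾ assocᴾ (atoms D) (atoms R) (atoms Q)) f
        (precompose {E ⊕ (R ⊕ Q)} (assoc⁻¹ᴾ (atoms E) (atoms R) (atoms Q)) (nf-⊗id n Q))

  ⟦nf-⊗id⟧ : ∀ {A B} (n : NF A B) Q → ⟦ nf-⊗id n Q ⟧ᴺ ≈ ⟦ n ⟧ᴺ ⊗₁ id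
  ⟦nf-⊗id⟧ {A} {B} (done p) Q = ≈.trans (shuffle-⊕ {A} {B} {Q} {Q} p (idᴾ (atoms Q))) (≈.refl ⟩⊗⟨ shuffle-id Q)
  ⟦nf-⊗id⟧ {A} {B} (apply {D} {E} {R} p f n) Q = begin
    shuffle (A ⊕ Q) (D ⊕ (R ⊕ Q)) ((p ⊕ᴾ idᴾ (atoms Q)) ⨾ᴾ assocᴾ (atoms D) (atoms R) (atoms Q)) ⨾ (f ⊗₁ id) ⨾
      ⟦ precompose {E ⊕ (R ⊕ Q)} (assoc⁻¹ᴾ (atoms E) (atoms R) (atoms Q)) (nf-⊗id n Q) ⟧ᴺ
      ≈⟨ first-shuffle ⟩⨾⟨ ≈.refl ⟩⨾⟨ rest ⟩
    ((shuffle A (D ⊕ R) p ⊗₁ id) ⨾ assoc) ⨾ (f ⊗₁ id) ⨾ assoc⁻¹ ⨾ (⟦ n ⟧ᴺ ⊗₁ id) ≈⟨ ⨾-assoc ⟩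
    (shuffle A (D ⊕ R) p ⊗₁ id) ⨾ assoc ⨾ (f ⊗₁ id) ⨾ assoc⁻¹ ⨾ (⟦ n ⟧ᴺ ⊗₁ id)
      ≈⟨ ⨾-congˡ (extendˡ assoc-nat-⊗id) ⟩
    (shuffle A (D ⊕ R) p ⊗₁ id) ⨾ ((f ⊗₁ id) ⊗₁ id) ⨾ assoc ⨾ assoc⁻¹ ⨾ (⟦ n ⟧ᴺ ⊗₁ id)
      ≈⟨ ⨾-congˡ (⨾-congˡ (≈.trans (pullˡ assoc-isoˡ) ⨾-idˡ)) ⟩
    (shuffle A (D ⊕ R) p ⊗₁ id) ⨾ ((f ⊗₁ id) ⊗₁ id) ⨾ (⟦ n ⟧ᴺ ⊗₁ id) ≈⟨ ≈.trans (⨾-congˡ ⨾-⊗id) ⨾-⊗id ⟩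
    (shuffle A (D ⊕ R) p ⨾ (f ⊗₁ id) ⨾ ⟦ n ⟧ᴺ) ⊗₁ id ∎
    where
    first-shuffle : shuffle (A ⊕ Q) (D ⊕ (R ⊕ Q)) ((p ⊕ᴾ idᴾ (atoms Q)) ⨾ᴾ assocᴾ (atoms D) (atoms R) (atoms Q)) ≈
                    (shuffle A (D ⊕ R) p ⊗₁ id) ⨾ assoc
    first-shuffle = ≈.trans (shuffle-⨾ {A ⊕ Q} {(D ⊕ R) ⊕ Q} {D ⊕ (R ⊕ Q)}
                                       (p ⊕ᴾ idᴾ (atoms Q)) (assocᴾ (atoms D) (atoms R) (atoms Q)))
                            (≈.trans (shuffle-⊕ {A} {D ⊕ R} {Q} {Q} p (idᴾ (atoms Q))) (≈.refl ⟩⊗⟨ shuffle-id Q)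
                             ⟩⨾⟨ ≈.sym (assoc≈shuffle {D} {R} {Q}))
    rest : ⟦ precompose {E ⊕ (R ⊕ Q)} (assoc⁻¹ᴾ (atoms E) (atoms R) (atoms Q)) (nf-⊗id n Q) ⟧ᴺ ≈
           assoc⁻¹ ⨾ (⟦ n ⟧ᴺ ⊗₁ id)
    rest = ≈.trans (⟦precompose⟧ {E ⊕ (R ⊕ Q)} (assoc⁻¹ᴾ (atoms E) (atoms R) (atoms Q)) (nf-⊗id n Q))
                   (≈.sym (assoc⁻¹≈shuffle {E} {R} {Q}) ⟩⨾⟨ ⟦nf-⊗id⟧ n Q)

  nf-id⊗ : ∀ {A B} Q → NF A B → NF (Q ⊕ A) (Q ⊕ B)
  nf-id⊗ Q (done p) = done (idᴾ (atoms Q) ⊕ᴾ p)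
  nf-id⊗ Q (apply {D} {E} {R} p f n) =
    apply {D = D} {E} {Q ⊕ R} ((idᴾ (atoms Q) ⊕ᴾ p) ⨾ᴾ τᴾ Q D R) f (precompose {E ⊕ (Q ⊕ R)} (τᴾ E Q R) (nf-id⊗ Q n))

  ⟦nf-id⊗⟧ : ∀ {A B} Q (n : NF A B) → ⟦ nf-id⊗ Q n ⟧ᴺ ≈ id ⊗₁ ⟦ n ⟧ᴺ
  ⟦nf-id⊗⟧ {A} {B} Q (done p) = ≈.trans (shuffle-⊕ {Q} {Q} {A} {B} (idᴾ (atoms Q)) p) (shuffle-id Q ⟩⊗⟨ ≈.refl)
  ⟦nf-id⊗⟧ {A} {B} Q (apply {D} {E} {R} p f n) = begin
    shuffle (Q ⊕ A) (D ⊕ (Q ⊕ R)) ((idᴾ (atoms Q) ⊕ᴾ p) ⨾ᴾ τᴾ Q D R) ⨾ (f ⊗₁ id) ⨾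
      ⟦ precompose {E ⊕ (Q ⊕ R)} (τᴾ E Q R) (nf-id⊗ Q n) ⟧ᴺ
      ≈⟨ first-shuffle ⟩⨾⟨ ≈.refl ⟩⨾⟨ rest ⟩
    ((id ⊗₁ shuffle A (D ⊕ R) p) ⨾ τ) ⨾ (f ⊗₁ id) ⨾ τ ⨾ (id ⊗₁ ⟦ n ⟧ᴺ) ≈⟨ ⨾-assoc ⟩
    (id ⊗₁ shuffle A (D ⊕ R) p) ⨾ τ ⨾ (f ⊗₁ id) ⨾ τ ⨾ (id ⊗₁ ⟦ n ⟧ᴺ)
      ≈⟨ ⨾-congˡ (⨾-congˡ (⨾-congʳ (≈.refl ⟩⊗⟨ ≈.sym ⊗-id))) ⟩
    (id ⊗₁ shuffle A (D ⊕ R) p) ⨾ τ ⨾ (f ⊗₁ (id ⊗₁ id)) ⨾ τ ⨾ (id ⊗₁ ⟦ n ⟧ᴺ)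
      ≈⟨ ⨾-congˡ (extendˡ (≈.sym τ-natural)) ⟩
    (id ⊗₁ shuffle A (D ⊕ R) p) ⨾ (id ⊗₁ (f ⊗₁ id)) ⨾ τ ⨾ τ ⨾ (id ⊗₁ ⟦ n ⟧ᴺ)
      ≈⟨ ⨾-congˡ (⨾-congˡ (≈.trans (pullˡ τ-involutive) ⨾-idˡ)) ⟩
    (id ⊗₁ shuffle A (D ⊕ R) p) ⨾ (id ⊗₁ (f ⊗₁ id)) ⨾ (id ⊗₁ ⟦ n ⟧ᴺ) ≈⟨ ≈.trans (⨾-congˡ ⨾-id⊗) ⨾-id⊗ ⟩
    id ⊗₁ (shuffle A (D ⊕ R) p ⨾ (f ⊗₁ id) ⨾ ⟦ n ⟧ᴺ) ∎
    where
    first-shuffle : shuffle (Q ⊕ A) (D ⊕ (Q ⊕ R)) ((idᴾ (atoms Q) ⊕ᴾ p) ⨾ᴾ τᴾ Q D R) ≈ (id ⊗₁ shuffle A (D ⊕ R) p) ⨾ τ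
    first-shuffle = ≈.trans (shuffle-⨾ {Q ⊕ A} {Q ⊕ (D ⊕ R)} {D ⊕ (Q ⊕ R)} (idᴾ (atoms Q) ⊕ᴾ p) (τᴾ Q D R))
                            (≈.trans (shuffle-⊕ {Q} {Q} {A} {D ⊕ R} (idᴾ (atoms Q)) p) (shuffle-id Q ⟩⊗⟨ ≈.refl)
                             ⟩⨾⟨ ≈.sym (τ≈shuffle Q D R))
    rest : ⟦ precompose {E ⊕ (Q ⊕ R)} (τᴾ E Q R) (nf-id⊗ Q n) ⟧ᴺ ≈ τ ⨾ (id ⊗₁ ⟦ n ⟧ᴺ)
    rest = ≈.trans (⟦precompose⟧ {E ⊕ (Q ⊕ R)} (τᴾ E Q R) (nf-id⊗ Q n)) (≈.sym (τ≈shuffle E Q R) ⟩⨾⟨ ⟦nf-id⊗⟧ Q n)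

  infixr 9 _⨾T_
  infixr 10 _⊗T_

  data Tm : Ob → Ob → Set where
    idT  : ∀ {A} → Tm A A
    _⨾T_ : ∀ {A B C} → Tm A B → Tm B C → Tm A C
    _⊗T_ : ∀ {A B C D} → Tm A B → Tm C D → Tm (A ⊕ C) (B ⊕ D)
    αT   : ∀ {A B C} → Tm ((A ⊕ B) ⊕ C) (A ⊕ (B ⊕ C))
    α⁻T  : ∀ {A B C} → Tm (A ⊕ (B ⊕ C)) ((A ⊕ B) ⊕ C)
    λT   : ∀ {A} → Tm (𝟙 ⊕ A) A
    λ⁻T  : ∀ {A} → Tm A (𝟙 ⊕ A)
    ρT   : ∀ {A} → Tm (A ⊕ 𝟙) A
    ρ⁻T  : ∀ {A} → Tm A (A ⊕ 𝟙)
    βT   : ∀ {A B} → Tm (A ⊕ B) (B ⊕ A)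
    box  : ∀ D E → ⟪ D ⟫ ⇒ ⟪ E ⟫ → Tm D E

  ⟦_⟧ᵀ : ∀ {A B} → Tm A B → ⟪ A ⟫ ⇒ ⟪ B ⟫
  ⟦ idT ⟧ᵀ = id
  ⟦ t ⨾T u ⟧ᵀ = ⟦ t ⟧ᵀ ⨾ ⟦ u ⟧ᵀ
  ⟦ t ⊗T u ⟧ᵀ = ⟦ t ⟧ᵀ ⊗₁ ⟦ u ⟧ᵀ
  ⟦ αT ⟧ᵀ = assoc
  ⟦ α⁻T ⟧ᵀ = assoc⁻¹
  ⟦ λT ⟧ᵀ = lunit
  ⟦ λ⁻T ⟧ᵀ = lunit⁻¹
  ⟦ ρT ⟧ᵀ = runit
  ⟦ ρ⁻T ⟧ᵀ = runit⁻¹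
  ⟦ βT ⟧ᵀ = braid
  ⟦ box D E f ⟧ᵀ = f

  normalise : ∀ {A B} → Tm A B → NF A B
  normalise (idT {A}) = done (idᴾ (atoms A))
  normalise (t ⨾T u) = normalise t ++ᴺ normalise u
  normalise (_⊗T_ {A} {B} {C} {D} t u) = nf-⊗id (normalise t) C ++ᴺ nf-id⊗ B (normalise u)
  normalise (αT {A} {B} {C}) = done (assocᴾ (atoms A) (atoms B) (atoms C))
  normalise (α⁻T {A} {B} {C}) = done (assoc⁻¹ᴾ (atoms A) (atoms B) (atoms C))
  normalise (λT {A}) = done (idᴾ (atoms A))
  normalise (λ⁻T {A}) = done (idᴾ (atoms A))
  normalise (ρT {A}) = done (runitᴾ (atoms A))
  normalise (ρ⁻T {A}) = done (runit⁻¹ᴾ (atoms A))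
  normalise (βT {A} {B}) = done (braidᴾ (atoms A) (atoms B))
  normalise (box D E f) = apply {D = D} {E} {𝟙} (runit⁻¹ᴾ (atoms D)) f (done (runitᴾ (atoms E)))

  normalise-sound : ∀ {A B} (t : Tm A B) → ⟦ t ⟧ᵀ ≈ ⟦ normalise t ⟧ᴺ
  normalise-sound (idT {A}) = id≈shuffle {A}
  normalise-sound (t ⨾T u) =
    ≈.trans (normalise-sound t ⟩⨾⟨ normalise-sound u) (≈.sym (⟦++ᴺ⟧ (normalise t) (normalise u)))
  normalise-sound (_⊗T_ {A} {B} {C} {D} t u) = begin
    ⟦ t ⟧ᵀ ⊗₁ ⟦ u ⟧ᵀ ≈⟨ ⊗-splitˡ ⟩
    (⟦ t ⟧ᵀ ⊗₁ id) ⨾ (id ⊗₁ ⟦ u ⟧ᵀ) ≈⟨ (normalise-sound t ⟩⊗⟨ ≈.refl) ⟩⨾⟨ (≈.refl ⟩⊗⟨ normalise-sound u) ⟩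
    (⟦ normalise t ⟧ᴺ ⊗₁ id) ⨾ (id ⊗₁ ⟦ normalise u ⟧ᴺ)
      ≈⟨ ⟦nf-⊗id⟧ (normalise t) C ⟩⨾⟨ ⟦nf-id⊗⟧ B (normalise u) ⟨
    ⟦ nf-⊗id (normalise t) C ⟧ᴺ ⨾ ⟦ nf-id⊗ B (normalise u) ⟧ᴺ
      ≈⟨ ⟦++ᴺ⟧ (nf-⊗id (normalise t) C) (nf-id⊗ B (normalise u)) ⟨
    ⟦ nf-⊗id (normalise t) C ++ᴺ nf-id⊗ B (normalise u) ⟧ᴺ ∎
  normalise-sound (αT {A} {B} {C}) = assoc≈shuffle {A} {B} {C}
  normalise-sound (α⁻T {A} {B} {C}) = assoc⁻¹≈shuffle {A} {B} {C}
  normalise-sound (λT {A}) = lunit≈shuffle {A}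
  normalise-sound (λ⁻T {A}) = lunit⁻¹≈shuffle {A}
  normalise-sound (ρT {A}) = runit≈shuffle {A}
  normalise-sound (ρ⁻T {A}) = runit⁻¹≈shuffle {A}
  normalise-sound (βT {A} {B}) = braid≈shuffle {A} {B}
  normalise-sound (box D E f) = begin
    f ≈⟨ ≈.trans (pullˡ runit-isoʳ) ⨾-idˡ ⟨
    runit⁻¹ ⨾ runit ⨾ f ≈⟨ ⨾-congˡ runit-nat ⟨
    runit⁻¹ ⨾ (f ⊗₁ id) ⨾ runit ≈⟨ runit⁻¹≈shuffle {D} ⟩⨾⟨ ≈.refl ⟩⨾⟨ runit≈shuffle {E} ⟩
    ⟦ normalise (box D E f) ⟧ᴺ ∎

  insert⁻¹ : ∀ {x zs ys} → Insert x zs ys → Perm ys (x ∷ zs)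
  insert⁻¹ {x} {zs} here = idᴾ (x ∷ zs)
  insert⁻¹ (there i) = there here ∷ insert⁻¹ i

  invᴾ : ∀ {xs ys} → Perm xs ys → Perm ys xs
  invᴾ [] = []
  invᴾ (i ∷ p) = insert⁻¹ i ⨾ᴾ (here ∷ invᴾ p)

  strip-prefix : ∀ ds {xs ys} → Perm (ds ++ xs) (ds ++ ys) → Maybe (Perm xs ys)
  strip-prefix [] p = just p
  strip-prefix (d ∷ ds) (here ∷ p) = strip-prefix ds p
  strip-prefix (d ∷ ds) (there i ∷ p) = nothing

  Box : Set
  Box = Σ Ob λ D → Σ Ob λ E → ⟪ D ⟫ ⇒ ⟪ E ⟫

  -- Boxes are compared by _≡_ and the wires passing alongside a box may be permuted. On concrete
  -- terms Compatible computes to a tuple of equations between closed normal forms, proved by refl.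
  mutual
    Compatible : ∀ {A B} → NF A B → NF A B → Set
    Compatible (done p) (done p') = p ≡ p'
    Compatible (done p) (apply p' f' n') = ⊥
    Compatible (apply p f n) (done p') = ⊥
    Compatible {A} {B} (apply {D} {E} {R} p f n) (apply {D'} {E'} {R'} p' f' n') =
      Σ (_≡_ {A = Box} (D , E , f) (D' , E' , f')) λ e → Compatible-apply {A} {B} e p n p' n'

    Compatible-apply : ∀ {A B D E R D' E' R'} {f : ⟪ D ⟫ ⇒ ⟪ E ⟫} {f' : ⟪ D' ⟫ ⇒ ⟪ E' ⟫} →
              _≡_ {A = Box} (D , E , f) (D' , E' , f') →
              Shuffle A (D ⊕ R) → NF (E ⊕ R) B → Shuffle A (D' ⊕ R') → NF (E' ⊕ R') B → Set
    Compatible-apply {A} {B} {D = D} {E} {R} {R' = R'} refl p n p' n' =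
      Compatible-rest {A} {B} {D = D} {E} {R} {R'} (strip-prefix (atoms D) (invᴾ p' ⨾ᴾ p)) p n p' n'

    Compatible-rest : ∀ {A B D E R R'} → Maybe (Perm (atoms R') (atoms R)) →
              Shuffle A (D ⊕ R) → NF (E ⊕ R) B → Shuffle A (D ⊕ R') → NF (E ⊕ R') B → Set
    Compatible-rest nothing p n p' n' = ⊥
    Compatible-rest {D = D} {E} {R} {R'} (just ρ) p n p' n' =
      (p ≡ p' ⨾ᴾ (atoms D ++ˡ ρ)) × Compatible (precompose {E ⊕ R'} {E ⊕ R} (atoms E ++ˡ ρ) n) n'

  interchange : ∀ {A B C D} {f : A ⇒ B} {g : C ⇒ D} → (id ⊗₁ g) ⨾ (f ⊗₁ id) ≈ (f ⊗₁ id) ⨾ (id ⊗₁ g)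
  interchange = ≈.trans (≈.sym ⊗-splitʳ) ⊗-splitˡ

  mutual
    compatible-sound : ∀ {A B} (n n' : NF A B) → Compatible n n' → ⟦ n ⟧ᴺ ≈ ⟦ n' ⟧ᴺ
    compatible-sound (done p) (done .p) refl = ≈.refl
    compatible-sound {A} {B} (apply p f n) (apply p' f' n') (e , c) = compatible-apply-sound {A} {B} e p n p' n' c

    compatible-apply-sound : ∀ {A B D E R D' E' R'} {f : ⟪ D ⟫ ⇒ ⟪ E ⟫} {f' : ⟪ D' ⟫ ⇒ ⟪ E' ⟫} →
              (e : _≡_ {A = Box} (D , E , f) (D' , E' , f')) →
              (p : Shuffle A (D ⊕ R)) (n : NF (E ⊕ R) B) (p' : Shuffle A (D' ⊕ R')) (n' : NF (E' ⊕ R') B) →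
              Compatible-apply {A} {B} e p n p' n' →
              shuffle A (D ⊕ R) p ⨾ (f ⊗₁ id) ⨾ ⟦ n ⟧ᴺ ≈ shuffle A (D' ⊕ R') p' ⨾ (f' ⊗₁ id) ⨾ ⟦ n' ⟧ᴺ
    compatible-apply-sound {A} {B} {D = D} {E} {R} {R' = R'} refl p n p' n' c =
      compatible-rest-sound {A} {B} {D = D} {E} {R} {R'} (strip-prefix (atoms D) (invᴾ p' ⨾ᴾ p)) p n p' n' c

    compatible-rest-sound : ∀ {A B D E R R'} {f : ⟪ D ⟫ ⇒ ⟪ E ⟫} (m : Maybe (Perm (atoms R') (atoms R))) →
              (p : Shuffle A (D ⊕ R)) (n : NF (E ⊕ R) B) (p' : Shuffle A (D ⊕ R')) (n' : NF (E ⊕ R') B) →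
              Compatible-rest {A} {B} {D = D} {E} {R} {R'} m p n p' n' →
              shuffle A (D ⊕ R) p ⨾ (f ⊗₁ id) ⨾ ⟦ n ⟧ᴺ ≈ shuffle A (D ⊕ R') p' ⨾ (f ⊗₁ id) ⨾ ⟦ n' ⟧ᴺ
    compatible-rest-sound {A} {B} {D} {E} {R} {R'} {f} (just ρ) .(p' ⨾ᴾ (atoms D ++ˡ ρ)) n p' n' (refl , c) = begin
      shuffle A (D ⊕ R) (p' ⨾ᴾ (atoms D ++ˡ ρ)) ⨾ (f ⊗₁ id) ⨾ ⟦ n ⟧ᴺ
        ≈⟨ ⨾-congʳ (shuffle-⨾ {A} {D ⊕ R'} {D ⊕ R} p' (atoms D ++ˡ ρ)) ⟩
      (shuffle A (D ⊕ R') p' ⨾ shuffle (D ⊕ R') (D ⊕ R) (atoms D ++ˡ ρ)) ⨾ (f ⊗₁ id) ⨾ ⟦ n ⟧ᴺ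
        ≈⟨ ≈.trans ⨾-assoc (⨾-congˡ (⨾-congʳ (shuffle-++ˡ {D} {R'} {R} ρ))) ⟩
      shuffle A (D ⊕ R') p' ⨾ (id ⊗₁ shuffle R' R ρ) ⨾ (f ⊗₁ id) ⨾ ⟦ n ⟧ᴺ ≈⟨ ⨾-congˡ (extendˡ interchange) ⟩
      shuffle A (D ⊕ R') p' ⨾ (f ⊗₁ id) ⨾ (id ⊗₁ shuffle R' R ρ) ⨾ ⟦ n ⟧ᴺ
        ≈⟨ ⨾-congˡ (⨾-congˡ (≈.trans (⟦precompose⟧ {E ⊕ R'} {E ⊕ R} (atoms E ++ˡ ρ) n)
                                     (⨾-congʳ (shuffle-++ˡ {E} {R'} {R} ρ)))) ⟨
      shuffle A (D ⊕ R') p' ⨾ (f ⊗₁ id) ⨾ ⟦ precompose {E ⊕ R'} {E ⊕ R} (atoms E ++ˡ ρ) n ⟧ᴺ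
        ≈⟨ ⨾-congˡ (⨾-congˡ (compatible-sound (precompose {E ⊕ R'} {E ⊕ R} (atoms E ++ˡ ρ) n) n' c)) ⟩
      shuffle A (D ⊕ R') p' ⨾ (f ⊗₁ id) ⨾ ⟦ n' ⟧ᴺ ∎

  solve : ∀ {A B} (t u : Tm A B) → Compatible (normalise t) (normalise u) → ⟦ t ⟧ᵀ ≈ ⟦ u ⟧ᵀ
  solve t u c = begin
    ⟦ t ⟧ᵀ ≈⟨ normalise-sound t ⟩
    ⟦ normalise t ⟧ᴺ ≈⟨ compatible-sound (normalise t) (normalise u) c ⟩
    ⟦ normalise u ⟧ᴺ ≈⟨ normalise-sound u ⟨
    ⟦ u ⟧ᵀ ∎

module Simulation (C : SymMonCat) where
  open Coherence C public

  infixr 9 _⨾ₛ_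
  infixr 10 _⊗ₛ_ _⊗ˢ_
  infix 4 _≈ₛ_

  _⊗ˢ_ : Seq C → Seq C → Seq C
  _⊗ˢ_ = Defs._⊗ˢ_ C

  _·_ : Obj → Seq C → Seq C
  _·_ = Defs._·_ C

  _·ₛ_ : ∀ {M' M'' X Y} → M' ⇒ M'' → Stream C (M'' · X) Y → Stream C (M' · X) Y
  _·ₛ_ = Defs._·ₛ_ C

  _⨾ₛ_ : ∀ {X Y Z} → Stream C X Y → Stream C Y Z → Stream C X Z
  _⨾ₛ_ = Defs._⨾ₛ_ C

  _⊗ₛ_ : ∀ {X Y X' Y'} → Stream C X Y → Stream C X' Y' → Stream C (X ⊗ˢ X') (Y ⊗ˢ Y')
  _⊗ₛ_ = Defs._⊗ₛ_ C

  _≈ₛ_ : ∀ {X Y} → Stream C X Y → Stream C X Y → Set₁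
  _≈ₛ_ = Defs._≈ₛ_ C

  -- A simulation supplies, at every stage at once, a memory map of the kind generating _≈ₛ_.
  record Simulation {X Y} (f g : Stream C X Y) : Set where
    field
      σ       : ∀ n → mem g n ⇒ mem f n
      σ-now   : act f 0 ≈ act g 0 ⨾ (σ 0 ⊗₁ id)
      σ-later : ∀ n → (σ n ⊗₁ id) ⨾ act f (suc n) ≈ act g (suc n) ⨾ (σ (suc n) ⊗₁ id)
  open Simulation public

  simulation-later : ∀ {X Y} {f g : Stream C X Y} (s : Simulation f g) →
                     Simulation (σ s 0 ·ₛ later C f) (later C g)
  simulation-later s = record { σ = λ n → σ s (suc n) ; σ-now = σ-later s 0 ; σ-later = λ n → σ-later s (suc n) }

  ≈⨾id⊗id : ∀ {A B D} {f : A ⇒ B ⊗₀ D} → f ≈ f ⨾ (id ⊗₁ id)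
  ≈⨾id⊗id = ≈.sym (≈.trans (⨾-congˡ ⊗-id) ⨾-idʳ)

  id⊗id-commutes : ∀ {A B D E} {f : A ⊗₀ B ⇒ D ⊗₀ E} → (id ⊗₁ id) ⨾ f ≈ f ⨾ (id ⊗₁ id)
  id⊗id-commutes = ≈.trans (≈.trans (⨾-congʳ ⊗-id) ⨾-idˡ) ≈⨾id⊗id

  simulation-by-≈ : ∀ {X Y} {m : ℕ → Obj} {a b : (n : ℕ) → In C m X n ⇒ m n ⊗₀ Y n} →
                    a 0 ≈ b 0 → (∀ n → a (suc n) ≈ b (suc n)) →
                    Simulation {X} {Y} (record { mem = m ; act = a }) (record { mem = m ; act = b })
  simulation-by-≈ a₀≈b₀ a₊≈b₊ = record
    { σ = λ n → id
    ; σ-now = ≈.trans a₀≈b₀ ≈⨾id⊗id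
    ; σ-later = λ n → ≈.trans (⨾-congˡ (a₊≈b₊ n)) id⊗id-commutes
    }

  Closure : StreamRel C → StreamRel C
  Closure Q = EqClosure (λ f g → Simulation f g ⊎ Q f g)

  -- Q is a bisimulation up to simulations and equivalence.
  Progresses : StreamRel C → Set
  Progresses Q = ∀ {X Y} {f g : Stream C X Y} → Q f g → EqClosure (Step C (Closure Q)) f g

  module _ (Q : StreamRel C) (progress : Progresses Q) where
    simulation-progresses : ∀ {X Y} {f g : Stream C X Y} → Simulation f g → Step C (Closure Q) f g
    simulation-progresses s = σ s 0 , σ-now s , fwd (inj₁ (simulation-later s)) ◅ ε

    generator-progresses : ∀ {X Y} {f g : Stream C X Y} →
                           Simulation f g ⊎ Q f g → EqClosure (Step C (Closure Q)) f g
    generator-progresses (inj₁ s) = fwd (simulation-progresses s) ◅ ε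
    generator-progresses (inj₂ q) = progress q

    closure-progresses : ∀ {X Y} {f g : Stream C X Y} →
                         Closure Q f g → EqClosure (Step C (Closure Q)) f g
    closure-progresses ε = ε
    closure-progresses (fwd r ◅ rs) = generator-progresses r ◅◅ closure-progresses rs
    closure-progresses (bwd r ◅ rs) =
      symmetric (Step C (Closure Q)) (generator-progresses r) ◅◅ closure-progresses rs

    closure⇒≈ₛ : ∀ {X Y} {f g : Stream C X Y} → Closure Q f g → f ≈ₛ g
    closure⇒≈ₛ c = Closure Q , closure-progresses , c

  by-generator : ∀ (Q : StreamRel C) {X Y} {f g : Stream C X Y} → Q f g → Closure Q f g
  by-generator Q q = fwd (inj₂ q) ◅ ε

  up-to-simulations : ∀ (Q : StreamRel C) {X Y} {f f' g' g : Stream C X Y} →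
                      Simulation f f' → Q f' g' → Simulation g' g → Closure Q f g
  up-to-simulations Q s q s' = fwd (inj₁ s) ◅ fwd (inj₂ q) ◅ fwd (inj₁ s') ◅ ε

  Empty : StreamRel C
  Empty _ _ = ⊥

  simulation⇒≈ₛ : ∀ {X Y} {f g : Stream C X Y} → Simulation f g → f ≈ₛ g
  simulation⇒≈ₛ s = closure⇒≈ₛ Empty (λ ()) (fwd (inj₁ s) ◅ ε)

  simulation⇒≈ₛ˘ : ∀ {X Y} {f g : Stream C X Y} → Simulation g f → f ≈ₛ g
  simulation⇒≈ₛ˘ s = closure⇒≈ₛ Empty (λ ()) (bwd (inj₁ s) ◅ ε)

module Congruence (C : SymMonCat) where
  open Simulation C public

  -- The stream fbk(f^A) of the paper: feedback of a stream whose first input carries a memory A.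
  -- The later part of fbk f, and of fbkᴹ f, is again of this form.
  fbkᴹ : ∀ {A S X Y} → Stream C (A · tail C (∂ C S ⊗ˢ X)) (tail C (S ⊗ˢ Y)) →
         Stream C ((A ⊗₀ S 0) · tail C X) (tail C Y)
  fbkᴹ {A} {S} {X} {Y} f = record { mem = λ n → mem f n ⊗₀ S (suc n) ; act = a }
    where
    a : (n : ℕ) → In C (λ n → mem f n ⊗₀ S (suc n)) ((A ⊗₀ S 0) · tail C X) n ⇒
                  (mem f n ⊗₀ S (suc n)) ⊗₀ tail C Y n
    a zero    = assoc ⨾ act f zero ⨾ assoc⁻¹
    a (suc n) = assoc ⨾ act f (suc n) ⨾ assoc⁻¹

  data FbkClosure (R : StreamRel C) : StreamRel C where
    fbk-base   : ∀ {X Y} {f g : Stream C X Y} → R f g → FbkClosure R f g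
    under-fbk  : ∀ {S X Y} {f g : Stream C (∂ C S ⊗ˢ X) (S ⊗ˢ Y)} →
                 R f g → FbkClosure R (fbk C {S} {X} {Y} f) (fbk C {S} {X} {Y} g)
    under-fbkᴹ : ∀ {A S X Y} {f g : Stream C (A · tail C (∂ C S ⊗ˢ X)) (tail C (S ⊗ˢ Y))} →
                 R f g → FbkClosure R (fbkᴹ {A} {S} {X} {Y} f) (fbkᴹ {A} {S} {X} {Y} g)

  module FbkCongruence (R : StreamRel C)
                       (R-progresses : ∀ {X Y} {f g : Stream C X Y} → R f g → EqClosure (Step C R) f g) where

    step-base : ∀ {X Y} {f g : Stream C X Y} → Step C R f g → Step C (Closure (FbkClosure R)) f g
    step-base (r , now≈ , rest) = r , now≈ , by-generator (FbkClosure R) (fbk-base rest)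

    step-fbk : ∀ {S X Y} {f g : Stream C (∂ C S ⊗ˢ X) (S ⊗ˢ Y)} →
               Step C R f g → Step C (Closure (FbkClosure R)) (fbk C f) (fbk C g)
    step-fbk {S} {X} {Y} {f} {g} (r , now≈ , rest) =
      r ⊗₁ id , now≈′ ,
      up-to-simulations (FbkClosure R) (simulation-by-≈ later-now≈ λ _ → ≈.refl)
                        (under-fbkᴹ {A = M C g} {S} {X} {Y} rest) (simulation-by-≈ ≈.refl λ _ → ≈.refl)
      where
      G₀ = box (𝟙 ⊕ ` X 0) (` M C g ⊕ (` S 0 ⊕ ` Y 0)) (act g 0)
      F₁ = box (` M C f ⊕ (` S 0 ⊕ ` X 1)) (` mem f 1 ⊕ (` S 1 ⊕ ` Y 1)) (act f 1)
      R₀ = box (` M C g) (` M C f) r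
      now≈′ : lunit⁻¹ ⨾ act f 0 ⨾ assoc⁻¹ ≈ (lunit⁻¹ ⨾ act g 0 ⨾ assoc⁻¹) ⨾ ((r ⊗₁ id) ⊗₁ id)
      now≈′ = ≈.trans (⨾-congˡ (⨾-congʳ now≈))
                (solve (λ⁻T ⨾T (G₀ ⨾T (R₀ ⊗T idT)) ⨾T α⁻T) ((λ⁻T ⨾T G₀ ⨾T α⁻T) ⨾T ((R₀ ⊗T idT) ⊗T idT))
                       (refl , refl , refl , refl , refl))
      later-now≈ : act ((r ⊗₁ id) ·ₛ later C (fbk C f)) 0 ≈ act (fbkᴹ {M C g} {S} {X} {Y} (r ·ₛ later C f)) 0
      later-now≈ = solve (((R₀ ⊗T idT) ⊗T idT) ⨾T αT ⨾T F₁ ⨾T α⁻T) (αT ⨾T ((R₀ ⊗T idT) ⨾T F₁) ⨾T α⁻T)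
                         (refl , refl , refl , refl , refl)

    step-fbkᴹ : ∀ {A S X Y} {f g : Stream C (A · tail C (∂ C S ⊗ˢ X)) (tail C (S ⊗ˢ Y))} →
                Step C R f g →
                Step C (Closure (FbkClosure R)) (fbkᴹ {A} {S} {X} {Y} f) (fbkᴹ {A} {S} {X} {Y} g)
    step-fbkᴹ {A} {S} {X} {Y} {f} {g} (r , now≈ , rest) =
      r ⊗₁ id , now≈′ ,
      up-to-simulations (FbkClosure R) (simulation-by-≈ later-now≈ λ _ → ≈.refl)
                        (under-fbkᴹ {A = M C g} {tail C S} {tail C X} {tail C Y} rest)
                        (simulation-by-≈ ≈.refl λ _ → ≈.refl)
      where
      G₀ = box (` A ⊕ (` S 0 ⊕ ` X 1)) (` M C g ⊕ (` S 1 ⊕ ` Y 1)) (act g 0)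
      F₁ = box (` M C f ⊕ (` S 1 ⊕ ` X 2)) (` mem f 1 ⊕ (` S 2 ⊕ ` Y 2)) (act f 1)
      R₀ = box (` M C g) (` M C f) r
      now≈′ : assoc ⨾ act f 0 ⨾ assoc⁻¹ ≈ (assoc ⨾ act g 0 ⨾ assoc⁻¹) ⨾ ((r ⊗₁ id) ⊗₁ id)
      now≈′ = ≈.trans (⨾-congˡ (⨾-congʳ now≈))
                (solve (αT ⨾T (G₀ ⨾T (R₀ ⊗T idT)) ⨾T α⁻T) ((αT ⨾T G₀ ⨾T α⁻T) ⨾T ((R₀ ⊗T idT) ⊗T idT))
                       (refl , refl , refl , refl , refl))
      later-now≈ : act ((r ⊗₁ id) ·ₛ later C (fbkᴹ {A} {S} {X} {Y} f)) 0 ≈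
                   act (fbkᴹ {M C g} {tail C S} {tail C X} {tail C Y} (r ·ₛ later C f)) 0
      later-now≈ = solve (((R₀ ⊗T idT) ⊗T idT) ⨾T αT ⨾T F₁ ⨾T α⁻T) (αT ⨾T ((R₀ ⊗T idT) ⨾T F₁) ⨾T α⁻T)
                         (refl , refl , refl , refl , refl)

    progresses : Progresses (FbkClosure R)
    progresses (fbk-base r)                   = map step-base (R-progresses r)
    progresses (under-fbk {S} {X} {Y} r)      = gmap (fbk C {S} {X} {Y}) step-fbk (R-progresses r)
    progresses (under-fbkᴹ {A} {S} {X} {Y} r) = gmap (fbkᴹ {A} {S} {X} {Y}) step-fbkᴹ (R-progresses r)

  fbk-cong : ∀ {S X Y} {f g : Stream C (∂ C S ⊗ˢ X) (S ⊗ˢ Y)} → f ≈ₛ g → fbk C f ≈ₛ fbk C g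
  fbk-cong (R , R-progresses , r) =
    closure⇒≈ₛ (FbkClosure R) (FbkCongruence.progresses R R-progresses) (by-generator (FbkClosure R) (under-fbk r))

  -- The later part of ∂ f, up to a simulation.
  lunit·ₛ : ∀ {X Y} → Stream C X Y → Stream C (I · X) Y
  lunit·ₛ {X} {Y} f = record { mem = mem f ; act = a }
    where
    a : (n : ℕ) → In C (mem f) (I · X) n ⇒ mem f n ⊗₀ Y n
    a zero    = lunit ⨾ act f zero
    a (suc n) = act f (suc n)

  -- Progressing from lunit·ₛ f consumes the first action of f, so under-lunit needs a Step of R.
  data DelayClosure (R : StreamRel C) : StreamRel C where
    ∂-base      : ∀ {X Y} {f g : Stream C X Y} → R f g → DelayClosure R f g
    under-∂     : ∀ {X Y} {f g : Stream C X Y} → R f g → DelayClosure R (∂ₛ C {X} {Y} f) (∂ₛ C {X} {Y} g)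
    under-lunit : ∀ {X Y} {f g : Stream C X Y} → Step C R f g → DelayClosure R (lunit·ₛ f) (lunit·ₛ g)

  module DelayCongruence (R : StreamRel C)
                         (R-progresses : ∀ {X Y} {f g : Stream C X Y} → R f g → EqClosure (Step C R) f g) where

    step-base : ∀ {X Y} {f g : Stream C X Y} → Step C R f g → Step C (Closure (DelayClosure R)) f g
    step-base (r , now≈ , rest) = r , now≈ , by-generator (DelayClosure R) (∂-base rest)

    step-∂ : ∀ {X Y} {f g : Stream C X Y} → Step C R f g → Step C (Closure (DelayClosure R)) (∂ₛ C f) (∂ₛ C g)
    step-∂ step = id , ≈⨾id⊗id ,
      up-to-simulations (DelayClosure R) (simulation-by-≈ (≈.trans (⨾-congʳ ⊗-id) ⨾-idˡ) λ _ → ≈.refl)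
                        (under-lunit step) (simulation-by-≈ ≈.refl λ _ → ≈.refl)

    step-lunit : ∀ {X Y} {f g : Stream C X Y} →
                 Step C R f g → Step C (Closure (DelayClosure R)) (lunit·ₛ f) (lunit·ₛ g)
    step-lunit (r , now≈ , rest) = r , ≈.trans (⨾-congˡ now≈) (≈.sym ⨾-assoc) ,
      up-to-simulations (DelayClosure R) (simulation-by-≈ ≈.refl λ _ → ≈.refl)
                        (∂-base rest) (simulation-by-≈ ≈.refl λ _ → ≈.refl)

    progresses : Progresses (DelayClosure R)
    progresses (∂-base r)          = map step-base (R-progresses r)
    progresses (under-∂ {X} {Y} r) = gmap (∂ₛ C {X} {Y}) step-∂ (R-progresses r)
    progresses (under-lunit step)  = fwd (step-lunit step) ◅ ε

  ∂-cong : ∀ {X Y} {f g : Stream C X Y} → f ≈ₛ g → ∂ₛ C f ≈ₛ ∂ₛ C g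
  ∂-cong (R , R-progresses , r) =
    closure⇒≈ₛ (DelayClosure R) (DelayCongruence.progresses R R-progresses)
               (by-generator (DelayClosure R) (under-∂ r))

module Axioms (C : SymMonCat) where
  open Congruence C public

  -- Terms denoting the first (-nowᵀ) and later (-laterᵀ) actions of _⨾ₛ_, _⊗ₛ_, fbk and lift.
  -- Applied to boxes holding the actions of the given streams, their denotations are definitionally
  -- the actions of the composite streams, so solve applies directly to the squares of a simulation.
  swapMidᵀ : ∀ {M' Y A} → Tm ((M' ⊕ Y) ⊕ A) ((M' ⊕ A) ⊕ Y)
  swapMidᵀ = αT ⨾T (idT ⊗T βT) ⨾T α⁻T

  ⨾-laterᵀ : ∀ {A B X₀ Y₀ Z₀ Mf Mg} → Tm (A ⊕ X₀) (Mf ⊕ Y₀) → Tm (B ⊕ Y₀) (Mg ⊕ Z₀) →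
             Tm ((A ⊕ B) ⊕ X₀) ((Mf ⊕ Mg) ⊕ Z₀)
  ⨾-laterᵀ a b = swapMidᵀ ⨾T (a ⊗T idT) ⨾T αT ⨾T (idT ⊗T βT) ⨾T (idT ⊗T b) ⨾T α⁻T

  exchᵀ : ∀ {A B C' D} → Tm ((A ⊕ B) ⊕ (C' ⊕ D)) ((A ⊕ C') ⊕ (B ⊕ D))
  exchᵀ = αT ⨾T (idT ⊗T (α⁻T ⨾T (βT ⊗T idT) ⨾T αT)) ⨾T α⁻T

  ⨾-nowᵀ : ∀ {X₀ Y₀ Z₀ Mf Mg} → Tm X₀ (Mf ⊕ Y₀) → Tm Y₀ (Mg ⊕ Z₀) → Tm X₀ ((Mf ⊕ Mg) ⊕ Z₀)
  ⨾-nowᵀ a b = a ⨾T (idT ⊗T b) ⨾T α⁻T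

  ⊗-nowᵀ : ∀ {X Y X' Y' M₁ M₂} → Tm X (M₁ ⊕ Y) → Tm X' (M₂ ⊕ Y') → Tm (X ⊕ X') ((M₁ ⊕ M₂) ⊕ (Y ⊕ Y'))
  ⊗-nowᵀ a b = (a ⊗T b) ⨾T exchᵀ

  ⊗-laterᵀ : ∀ {X Y X' Y' M₁ M₂ N₁ N₂} → Tm (N₁ ⊕ X) (M₁ ⊕ Y) → Tm (N₂ ⊕ X') (M₂ ⊕ Y') →
           Tm ((N₁ ⊕ N₂) ⊕ (X ⊕ X')) ((M₁ ⊕ M₂) ⊕ (Y ⊕ Y'))
  ⊗-laterᵀ a b = exchᵀ ⨾T (a ⊗T b) ⨾T exchᵀ

  fbk-nowᵀ : ∀ {X M' S Y} → Tm (𝟙 ⊕ X) (M' ⊕ (S ⊕ Y)) → Tm X ((M' ⊕ S) ⊕ Y)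
  fbk-nowᵀ a = λ⁻T ⨾T a ⨾T α⁻T

  fbk-laterᵀ : ∀ {N S X M' S' Y} → Tm (N ⊕ (S ⊕ X)) (M' ⊕ (S' ⊕ Y)) → Tm ((N ⊕ S) ⊕ X) ((M' ⊕ S') ⊕ Y)
  fbk-laterᵀ a = αT ⨾T a ⨾T α⁻T

  lift-nowᵀ : ∀ {X Y} → Tm X Y → Tm X (𝟙 ⊕ Y)
  lift-nowᵀ φ = φ ⨾T λ⁻T

  lift-laterᵀ : ∀ {X Y} → Tm X Y → Tm (𝟙 ⊕ X) (𝟙 ⊕ Y)
  lift-laterᵀ φ = λT ⨾T φ ⨾T λ⁻T

  ∂-id-simulation : ∀ {X} → Simulation (∂ₛ C (idₛ C X)) (idₛ C (∂ C X))
  ∂-id-simulation {X} = record { σ = σ′ ; σ-now = ≈⨾id⊗id ; σ-later = square }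
    where
    σ′ : ∀ n → I ⇒ mem (∂ₛ C (idₛ C X)) n
    σ′ zero = id
    σ′ (suc n) = id
    square : ∀ n → (σ′ n ⊗₁ id) ⨾ act (∂ₛ C (idₛ C X)) (suc n) ≈ act (idₛ C (∂ C X)) (suc n) ⨾ (σ′ (suc n) ⊗₁ id)
    square zero = solve ((idT ⊗T idT) ⨾T λT ⨾T λ⁻T) (idT ⨾T (idT ⊗T idT {` X 0})) refl
    square (suc n) = id⊗id-commutes

  ∂-⨾-simulation : ∀ {X Y Z} (f : Stream C X Y) (g : Stream C Y Z) → Simulation (∂ₛ C (f ⨾ₛ g)) (∂ₛ C f ⨾ₛ ∂ₛ C g)
  ∂-⨾-simulation {X} {Y} {Z} f g = record { σ = σ′ ; σ-now = square₀ ; σ-later = square }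
    where
    σ′ : ∀ n → mem (∂ₛ C f ⨾ₛ ∂ₛ C g) n ⇒ mem (∂ₛ C (f ⨾ₛ g)) n
    σ′ zero = lunit
    σ′ (suc n) = id
    square₀ = solve (λ⁻T {𝟙}) (⨾-nowᵀ λ⁻T λ⁻T ⨾T (λT ⊗T idT)) refl
    F₀ = box (` X 0) (` mem f 0 ⊕ ` Y 0) (act f 0)
    G₀ = box (` Y 0) (` mem g 0 ⊕ ` Z 0) (act g 0)
    square : ∀ n → (σ′ n ⊗₁ id) ⨾ act (∂ₛ C (f ⨾ₛ g)) (suc n) ≈
              act (∂ₛ C f ⨾ₛ ∂ₛ C g) (suc n) ⨾ (σ′ (suc n) ⊗₁ id)
    square zero = solve ((λT ⊗T idT) ⨾T λT ⨾T ⨾-nowᵀ F₀ G₀)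
                   (⨾-laterᵀ (λT ⨾T F₀) (λT ⨾T G₀) ⨾T (idT ⊗T idT))
                   (refl , refl , refl , refl , refl)
    square (suc n) = id⊗id-commutes

  ∂-⊗-simulation : ∀ {X Y X' Y'} (f : Stream C X Y) (g : Stream C X' Y') →
    Simulation (∂ₛ C (f ⊗ₛ g) ⨾ₛ ∂-⊗ C Y Y') (∂-⊗ C X X' ⨾ₛ (∂ₛ C f ⊗ₛ ∂ₛ C g))
  ∂-⊗-simulation {X} {Y} {X'} {Y'} f g = record { σ = σ′ ; σ-now = square₀ ; σ-later = square }
    where
    σ′ : ∀ n → mem (∂-⊗ C X X' ⨾ₛ (∂ₛ C f ⊗ₛ ∂ₛ C g)) n ⇒ mem (∂ₛ C (f ⊗ₛ g) ⨾ₛ ∂-⊗ C Y Y') n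
    σ′ zero = lunit
    σ′ (suc n) = lunit ⨾ runit⁻¹
    square₀ = solve (⨾-nowᵀ (λ⁻T {𝟙}) (lift-nowᵀ (λ⁻T {𝟙})))
                    (⨾-nowᵀ (lift-nowᵀ (λ⁻T {𝟙})) (⊗-nowᵀ (λ⁻T {𝟙}) (λ⁻T {𝟙})) ⨾T (λT ⊗T idT)) refl
    F₀ = box (` X 0) (` mem f 0 ⊕ ` Y 0) (act f 0)
    G₀ = box (` X' 0) (` mem g 0 ⊕ ` Y' 0) (act g 0)
    square : ∀ n → (σ′ n ⊗₁ id) ⨾ act (∂ₛ C (f ⊗ₛ g) ⨾ₛ ∂-⊗ C Y Y') (suc n) ≈
              act (∂-⊗ C X X' ⨾ₛ (∂ₛ C f ⊗ₛ ∂ₛ C g)) (suc n) ⨾ (σ′ (suc n) ⊗₁ id)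
    square zero = solve ((λT ⊗T idT) ⨾T ⨾-laterᵀ (λT ⨾T ⊗-nowᵀ F₀ G₀) (lift-laterᵀ idT))
                   (⨾-laterᵀ (lift-laterᵀ idT) (⊗-laterᵀ (λT ⨾T F₀) (λT ⨾T G₀)) ⨾T ((λT ⨾T ρ⁻T) ⊗T idT))
                   (refl , refl , refl , refl , refl)
    square (suc n) = solve (((λT ⨾T ρ⁻T) ⊗T idT) ⨾T ⨾-laterᵀ (⊗-laterᵀ Fn Gn) (lift-laterᵀ idT))
                   (⨾-laterᵀ (lift-laterᵀ idT) (⊗-laterᵀ Fn Gn) ⨾T ((λT ⨾T ρ⁻T) ⊗T idT))
                   (refl , refl , refl , refl , refl)
      where
      Fn = box (` mem f n ⊕ ` X (suc n)) (` mem f (suc n) ⊕ ` Y (suc n)) (act f (suc n))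
      Gn = box (` mem g n ⊕ ` X' (suc n)) (` mem g (suc n) ⊕ ` Y' (suc n)) (act g (suc n))

  vanishing-simulation : ∀ {X Y} (f : Stream C X Y) → Simulation (fbk C {Iˢ C} ((unitIn C X ⨾ₛ f) ⨾ₛ unitOut C Y)) f
  vanishing-simulation {X} {Y} f =
    record { σ = λ n → ⟦ σᵀ n ⟧ᵀ ; σ-now = square₀ ; σ-later = square }
    where
    σᵀ : ∀ n → Tm (` mem f n) (((𝟙 ⊕ ` mem f n) ⊕ 𝟙) ⊕ 𝟙)
    σᵀ n = λ⁻T ⨾T ρ⁻T ⨾T ρ⁻T
    F₀ = box (` X 0) (` mem f 0 ⊕ ` Y 0) (act f 0)
    square₀ = solve (fbk-nowᵀ (⨾-nowᵀ (⨾-nowᵀ (lift-nowᵀ λT) F₀) (lift-nowᵀ λ⁻T))) (F₀ ⨾T (σᵀ 0 ⊗T idT))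
               (refl , refl , refl)
    square : ∀ n → (⟦ σᵀ n ⟧ᵀ ⊗₁ id) ⨾ act (fbk C {Iˢ C} ((unitIn C X ⨾ₛ f) ⨾ₛ unitOut C Y)) (suc n) ≈
              act f (suc n) ⨾ (⟦ σᵀ (suc n) ⟧ᵀ ⊗₁ id)
    square n = solve ((σᵀ n ⊗T idT) ⨾T fbk-laterᵀ (⨾-laterᵀ (⨾-laterᵀ (lift-laterᵀ λT) Fn) (lift-laterᵀ λ⁻T)))
                (Fn ⨾T (σᵀ (suc n) ⊗T idT)) (refl , refl , refl)
      where
      Fn = box (` mem f n ⊕ ` X (suc n)) (` mem f (suc n) ⊕ ` Y (suc n)) (act f (suc n))

  joining-simulation : ∀ {S T X Y} (f : Stream C (∂ C S ⊗ˢ (∂ C T ⊗ˢ X)) (S ⊗ˢ (T ⊗ˢ Y))) →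
    Simulation (fbk C {T} (fbk C {S} f)) (fbk C {S ⊗ˢ T} ((joinIn C S T X ⨾ₛ f) ⨾ₛ joinOut C S T Y))
  joining-simulation {S} {T} {X} {Y} f =
    record { σ = λ n → ⟦ σᵀ n ⟧ᵀ ; σ-now = square₀ ; σ-later = square }
    where
    σᵀ : ∀ n → Tm (((𝟙 ⊕ ` mem f n) ⊕ 𝟙) ⊕ (` S n ⊕ ` T n)) ((` mem f n ⊕ ` S n) ⊕ ` T n)
    σᵀ n = ((ρT ⨾T λT) ⊗T idT) ⨾T α⁻T
    F₀ = box (𝟙 ⊕ (𝟙 ⊕ ` X 0)) (` mem f 0 ⊕ (` S 0 ⊕ (` T 0 ⊕ ` Y 0))) (act f 0)
    square₀ = solve (fbk-nowᵀ (fbk-nowᵀ F₀))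
               (fbk-nowᵀ (⨾-nowᵀ (⨾-nowᵀ (lift-nowᵀ ((λ⁻T ⊗T idT) ⨾T αT)) F₀) (lift-nowᵀ α⁻T)) ⨾T (σᵀ 0 ⊗T idT))
               (refl , refl , refl)
    square : ∀ n → (⟦ σᵀ n ⟧ᵀ ⊗₁ id) ⨾ act (fbk C {T} (fbk C {S} f)) (suc n) ≈
              act (fbk C {S ⊗ˢ T} ((joinIn C S T X ⨾ₛ f) ⨾ₛ joinOut C S T Y)) (suc n) ⨾ (⟦ σᵀ (suc n) ⟧ᵀ ⊗₁ id)
    square n = solve ((σᵀ n ⊗T idT) ⨾T fbk-laterᵀ (fbk-laterᵀ Fn))
                (fbk-laterᵀ (⨾-laterᵀ (⨾-laterᵀ (lift-laterᵀ αT) Fn) (lift-laterᵀ α⁻T)) ⨾T (σᵀ (suc n) ⊗T idT))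
                (refl , refl , refl)
      where
      Fn = box (` mem f n ⊕ (` S n ⊕ (` T n ⊕ ` X (suc n))))
               (` mem f (suc n) ⊕ (` S (suc n) ⊕ (` T (suc n) ⊕ ` Y (suc n)))) (act f (suc n))

  strength-simulation : ∀ {S X Y X' Y'} (f : Stream C (∂ C S ⊗ˢ X) (S ⊗ˢ Y)) (g : Stream C X' Y') →
    Simulation (fbk C f ⊗ₛ g)
        (fbk C {S} ((assocˢ⁻¹ C (∂ C S) X X' ⨾ₛ (f ⊗ₛ g)) ⨾ₛ assocˢ C S Y Y'))
  strength-simulation {S} {X} {Y} {X'} {Y'} f g =
    record { σ = λ n → ⟦ σᵀ n ⟧ᵀ ; σ-now = square₀ ; σ-later = square }
    where
    σᵀ : ∀ n → Tm (((𝟙 ⊕ (` mem f n ⊕ ` mem g n)) ⊕ 𝟙) ⊕ ` S n) ((` mem f n ⊕ ` S n) ⊕ ` mem g n)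
    σᵀ n = ((ρT ⨾T λT) ⊗T idT) ⨾T αT ⨾T (idT ⊗T βT) ⨾T α⁻T
    F₀ = box (𝟙 ⊕ ` X 0) (` mem f 0 ⊕ (` S 0 ⊕ ` Y 0)) (act f 0)
    G₀ = box (` X' 0) (` mem g 0 ⊕ ` Y' 0) (act g 0)
    square₀ = solve (⊗-nowᵀ (fbk-nowᵀ F₀) G₀)
               (fbk-nowᵀ (⨾-nowᵀ (⨾-nowᵀ (lift-nowᵀ α⁻T) (⊗-nowᵀ F₀ G₀)) (lift-nowᵀ αT)) ⨾T (σᵀ 0 ⊗T idT))
               (refl , refl , refl , refl , refl)
    square : ∀ n → (⟦ σᵀ n ⟧ᵀ ⊗₁ id) ⨾ act (fbk C f ⊗ₛ g) (suc n) ≈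
              act (fbk C {S} ((assocˢ⁻¹ C (∂ C S) X X' ⨾ₛ (f ⊗ₛ g)) ⨾ₛ assocˢ C S Y Y')) (suc n)
                ⨾ (⟦ σᵀ (suc n) ⟧ᵀ ⊗₁ id)
    square n = solve ((σᵀ n ⊗T idT) ⨾T ⊗-laterᵀ (fbk-laterᵀ Fn) Gn)
                (fbk-laterᵀ (⨾-laterᵀ (⨾-laterᵀ (lift-laterᵀ α⁻T) (⊗-laterᵀ Fn Gn)) (lift-laterᵀ αT))
                  ⨾T (σᵀ (suc n) ⊗T idT))
                (refl , refl , refl , refl , refl)
      where
      Fn = box (` mem f n ⊕ (` S n ⊕ ` X (suc n))) (` mem f (suc n) ⊕ (` S (suc n) ⊕ ` Y (suc n))) (act f (suc n))
      Gn = box (` mem g n ⊕ ` X' (suc n)) (` mem g (suc n) ⊕ ` Y' (suc n)) (act g (suc n))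

  tightening-simulation : ∀ {S X X' Y Y'}
                          (u : Stream C X' X) (f : Stream C (∂ C S ⊗ˢ X) (S ⊗ˢ Y)) (v : Stream C Y Y') →
    Simulation ((u ⨾ₛ fbk C f) ⨾ₛ v)
        (fbk C (((idₛ C (∂ C S) ⊗ₛ u) ⨾ₛ f) ⨾ₛ (idₛ C S ⊗ₛ v)))
  tightening-simulation {S} {X} {X'} {Y} {Y'} u f v =
    record { σ = λ n → ⟦ σᵀ n ⟧ᵀ ; σ-now = square₀ ; σ-later = square }
    where
    σᵀ : ∀ n → Tm ((((𝟙 ⊕ ` mem u n) ⊕ ` mem f n) ⊕ (𝟙 ⊕ ` mem v n)) ⊕ ` S n)
                 ((` mem u n ⊕ (` mem f n ⊕ ` S n)) ⊕ ` mem v n)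
    σᵀ n = ((((λT ⊗T idT) ⊗T λT) ⊗T idT) ⨾T αT ⨾T (idT ⊗T βT) ⨾T α⁻T ⨾T (αT ⊗T idT))
    U₀ = box (` X' 0) (` mem u 0 ⊕ ` X 0) (act u 0)
    F₀ = box (𝟙 ⊕ ` X 0) (` mem f 0 ⊕ (` S 0 ⊕ ` Y 0)) (act f 0)
    V₀ = box (` Y 0) (` mem v 0 ⊕ ` Y' 0) (act v 0)
    square₀ = solve (⨾-nowᵀ (⨾-nowᵀ U₀ (fbk-nowᵀ F₀)) V₀)
               (fbk-nowᵀ (⨾-nowᵀ (⨾-nowᵀ (⊗-nowᵀ (λ⁻T {𝟙}) U₀) F₀) (⊗-nowᵀ (λ⁻T {` S 0}) V₀)) ⨾T (σᵀ 0 ⊗T idT))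
               (refl , refl , refl , refl , refl , refl , refl)
    square : ∀ n → (⟦ σᵀ n ⟧ᵀ ⊗₁ id) ⨾ act ((u ⨾ₛ fbk C f) ⨾ₛ v) (suc n) ≈
              act (fbk C (((idₛ C (∂ C S) ⊗ₛ u) ⨾ₛ f) ⨾ₛ (idₛ C S ⊗ₛ v))) (suc n)
                ⨾ (⟦ σᵀ (suc n) ⟧ᵀ ⊗₁ id)
    square n = solve ((σᵀ n ⊗T idT) ⨾T ⨾-laterᵀ (⨾-laterᵀ Un (fbk-laterᵀ Fn)) Vn)
                (fbk-laterᵀ (⨾-laterᵀ (⨾-laterᵀ (⊗-laterᵀ (idT {𝟙 ⊕ ` S n}) Un) Fn)
                                      (⊗-laterᵀ (idT {𝟙 ⊕ ` S (suc n)}) Vn))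
                  ⨾T (σᵀ (suc n) ⊗T idT))
                (refl , refl , refl , refl , refl , refl , refl)
      where
      Un = box (` mem u n ⊕ ` X' (suc n)) (` mem u (suc n) ⊕ ` X (suc n)) (act u (suc n))
      Fn = box (` mem f n ⊕ (` S n ⊕ ` X (suc n))) (` mem f (suc n) ⊕ (` S (suc n) ⊕ ` Y (suc n))) (act f (suc n))
      Vn = box (` mem v n ⊕ ` Y (suc n)) (` mem v (suc n) ⊕ ` Y' (suc n)) (act v (suc n))

  sliding-simulation : ∀ {S T X Y} (h : Stream C S T) (f : Stream C (∂ C T ⊗ˢ X) (S ⊗ˢ Y)) →
    Simulation (fbk C {T} (f ⨾ₛ (h ⊗ₛ idₛ C Y))) (fbk C {S} ((∂ₛ C h ⊗ₛ idₛ C X) ⨾ₛ f))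
  sliding-simulation {S} {T} {X} {Y} h f = record { σ = σ′ ; σ-now = square₀ ; σ-later = square }
    where
    H₊ : ∀ n → Tm (` mem h n ⊕ ` S (suc n)) (` mem h (suc n) ⊕ ` T (suc n))
    H₊ n = box (` mem h n ⊕ ` S (suc n)) (` mem h (suc n) ⊕ ` T (suc n)) (act h (suc n))
    H₀ = box (` S 0) (` mem h 0 ⊕ ` T 0) (act h 0)
    σ₀ᵀ : Tm (((𝟙 ⊕ 𝟙) ⊕ ` mem f 0) ⊕ ` S 0) ((` mem f 0 ⊕ (` mem h 0 ⊕ 𝟙)) ⊕ ` T 0)
    σ₀ᵀ = ((λT ⊗T idT) ⊗T idT) ⨾T (λT ⊗T idT) ⨾T (idT ⊗T H₀) ⨾T (idT ⊗T (ρ⁻T ⊗T idT)) ⨾T α⁻T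
    σ₊ᵀ : ∀ m → Tm ((((` mem h m ⊕ 𝟙) ⊕ ` mem f (suc m)) ⊕ ` S (suc m)))
                  ((` mem f (suc m) ⊕ (` mem h (suc m) ⊕ 𝟙)) ⊕ ` T (suc m))
    σ₊ᵀ m = ((ρT ⊗T idT) ⊗T idT) ⨾T (βT ⊗T idT) ⨾T αT ⨾T (idT ⊗T H₊ m) ⨾T (idT ⊗T (ρ⁻T ⊗T idT)) ⨾T α⁻T
    -- The memory maps pass the stored S-wire through h, yielding the T-wire stored on the left.
    σ′ : ∀ n → mem (fbk C {S} ((∂ₛ C h ⊗ₛ idₛ C X) ⨾ₛ f)) n ⇒
               mem (fbk C {T} (f ⨾ₛ (h ⊗ₛ idₛ C Y))) n
    σ′ zero = ⟦ σ₀ᵀ ⟧ᵀ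
    σ′ (suc m) = ⟦ σ₊ᵀ m ⟧ᵀ
    F₀ = box (𝟙 ⊕ ` X 0) (` mem f 0 ⊕ (` S 0 ⊕ ` Y 0)) (act f 0)
    square₀ = solve (fbk-nowᵀ (⨾-nowᵀ F₀ (⊗-nowᵀ H₀ λ⁻T)))
               (fbk-nowᵀ (⨾-nowᵀ (⊗-nowᵀ (λ⁻T {𝟙}) (λ⁻T {` X 0})) F₀) ⨾T (σ₀ᵀ ⊗T idT))
               (refl , refl , refl , refl , refl)
    square : ∀ n → (σ′ n ⊗₁ id) ⨾ act (fbk C {T} (f ⨾ₛ (h ⊗ₛ idₛ C Y))) (suc n) ≈
              act (fbk C {S} ((∂ₛ C h ⊗ₛ idₛ C X) ⨾ₛ f)) (suc n) ⨾ (σ′ (suc n) ⊗₁ id)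
    square zero = solve ((σ₀ᵀ ⊗T idT) ⨾T fbk-laterᵀ (⨾-laterᵀ F₁ (⊗-laterᵀ (H₊ 0) (idT {𝟙 ⊕ ` Y 1}))))
                   (fbk-laterᵀ (⨾-laterᵀ (⊗-laterᵀ (λT ⨾T H₀) (idT {𝟙 ⊕ ` X 1})) F₁) ⨾T (σ₊ᵀ 0 ⊗T idT))
                   (refl , refl , refl , refl , refl , refl , refl)
      where
      F₁ = box (` mem f 0 ⊕ (` T 0 ⊕ ` X 1)) (` mem f 1 ⊕ (` S 1 ⊕ ` Y 1)) (act f 1)
    square (suc m) =
      solve ((σ₊ᵀ m ⊗T idT) ⨾T fbk-laterᵀ (⨾-laterᵀ Fm (⊗-laterᵀ (H₊ (suc m)) (idT {𝟙 ⊕ ` Y (suc (suc m))}))))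
            (fbk-laterᵀ (⨾-laterᵀ (⊗-laterᵀ (H₊ m) (idT {𝟙 ⊕ ` X (suc (suc m))})) Fm) ⨾T (σ₊ᵀ (suc m) ⊗T idT))
            (refl , refl , refl , refl , refl , refl , refl)
      where
      Fm = box (` mem f (suc m) ⊕ (` T (suc m) ⊕ ` X (suc (suc m))))
               (` mem f (suc (suc m)) ⊕ (` S (suc (suc m)) ⊕ ` Y (suc (suc m)))) (act f (suc (suc m)))

theorem7p26 : (C : SymMonCat) → Productive C → IsFeedbackStream C
theorem7p26 C _ = record
  { ∂-cong     = ∂-cong
  ; ∂-id       = simulation⇒≈ₛ ∂-id-simulation
  ; ∂-⨾        = λ f g → simulation⇒≈ₛ (∂-⨾-simulation f g)
  ; ∂-⊗-nat    = λ f g → simulation⇒≈ₛ (∂-⊗-simulation f g)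
  ; fbk-cong   = fbk-cong
  ; tightening = λ u f v → simulation⇒≈ₛ (tightening-simulation u f v)
  ; vanishing  = λ f → simulation⇒≈ₛ (vanishing-simulation f)
  ; joining    = λ f → simulation⇒≈ₛ (joining-simulation f)
  ; strength   = λ f g → simulation⇒≈ₛ (strength-simulation f g)
  ; sliding    = λ h f → simulation⇒≈ₛ˘ (sliding-simulation h f)
  }
  where open Axioms C
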